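{- Let $p$ be an odd prime. Then \[ \sum_{k=1}^{\frac{p-1}{2}}\frac{\binom{2k}{k}}{2^k}\equiv -\frac{p}{2}\left(\frac{ -1}{p}\right)\sum_{k=1}^{\frac{p-1}{2}}\frac{2^k}{k}+\left(\frac{ -1}{p}\right)-1 \pmod{p^2}, \] and \[ \sum_{k=1}^{\frac{p-1}{2}}\frac{\binom{2k}{k}}{2^k}\equiv \left(\frac{ -1}{p}\right)-1 \pmod{p}. \]
   Context: Here $\left(\frac{\cdot}{p}\right)$ is the Legendre symbol. Congruences between rational numbers whose denominators are prime to $p$ are understood in the ring of $p$-integral rationals: $a\equiv b \pmod{p^m}$ means $(a-b)/p^m$ is a rational number with denominator prime to $p$. -}

module Defs where

open import Data.Nat as ℕ using (ℕ; zero; suc; _^_; _∸_; _/_)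
open import Data.Nat.Divisibility using (_∣_; _∣?_)
open import Data.List using (upTo)
open import Data.List.Relation.Unary.Any using (any?)
open import Relation.Nullary.Decidable using (does)
open import Data.Bool using (if_then_else_)
open import Data.Nat.Properties using (m^n≢0)
open import Data.Nat.Combinatorics using (_C_)
open import Data.Nat.Coprimality using (Coprime)
open import Data.Integer as ℤ using (ℤ; +_)
open import Data.Rational as ℚ using (ℚ; _+_; _-_; _*_; ↧ₙ_)
open import Data.Product using (Σ; _×_)
open import Relation.Binary.PropositionalEquality using (_≡_)
open import Relation.Nullary using (¬_)

sumFrom1 : ℕ → (ℕ → ℚ) → ℚ
sumFrom1 zero    f = ℚ.0ℚ
sumFrom1 (suc n) f = sumFrom1 n f + f (suc n)

nℚ : ℕ → ℚ
nℚ n = (+ n) ℚ./ 1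

termA : ℕ → ℚ
termA k = ((+ ((2 ℕ.* k) C k)) ℚ./ (2 ^ k)) {{m^n≢0 2 k}}

-- 2^k / k  (only used for k ≥ 1)
termB : ℕ → ℚ
termB zero    = ℚ.0ℚ
termB (suc j) = (+ (2 ^ suc j)) ℚ./ suc j

-- a ≡ b (mod p^m) in the ring of p-integral rationals:
-- (a - b) / p^m is a rational whose (reduced) denominator is prime to p
CongModPow : ℕ → ℕ → ℚ → ℚ → Set
CongModPow p m a b = Σ ℚ (λ r → (a - b ≡ nℚ (p ^ m) * r) × Coprime (↧ₙ r) p)

-- Legendre symbol (-1 / p) for an odd prime p:
-- 1 if -1 is a quadratic residue mod p (∃ x with p ∣ x² + 1), else -1
-- (p ∤ -1 always, so the value 0 never occurs).
legendreMinus1 : ℕ → ℚ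
legendreMinus1 p =
  if does (any? (λ x → p ∣? (x ℕ.* x ℕ.+ 1)) (upTo p)) then ℚ.1ℚ else ℚ.- ℚ.1ℚ

-- Write p = 2n + 1.  Since 2j + 1 = p - 2(n - j), the central term
-- C(2k,k)/2^k = ∏_{j<k} (2j+1)/(j+1) equals C(n,k) (-2)^k ∏_{j<k} (1 - p/(2(n-j))), which modulo p²
-- is C(n,k) (-2)^k (1 - (p/2)(H_n - H_{n-k})).  Summing over k ≤ n, the binomial theorem gives
-- Σ C(n,k) (-2)^k = (-1)^n, and W_n(x) = Σ_k C(n,k) x^k (H_n - H_{n-k}) satisfies
-- W_{n+1} = (1+x) W_n + x^{n+1}/(n+1), whence W_n(-2) = (-1)^n Σ_{k=1}^n 2^k/k.
-- It remains to see (-1/p) = (-1)^n.  Wilson's theorem, which follows from the finite-difference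
-- identity Σ_k (-1)^k C(p-1,k) k^{p-1} = (p-1)!, Fermat and (-1)^k C(p-1,k) ≡ 1, gives
-- (-1)^n (n!)² ≡ -1.  So n! is a square root of -1 when n is even, while for odd n a square
-- root x of -1 would give 1 ≡ x^{p-1} = (x²)^n ≡ -1.

module Submission where

open import Defs
open import Data.Nat as ℕ using (ℕ; zero; suc; _≤_; _<_; z≤n; s≤s; _!; _∸_; _/_)
import Data.Nat.Properties as ℕₚ
open import Algebra.Properties.CommutativeSemigroup ℕₚ.*-commutativeSemigroup using (x∙yz≈y∙xz)
open import Data.Nat.Combinatorics using (_C_; nCk+nC[k+1]≡[n+1]C[k+1])
open import Data.Nat.Coprimality as Coprimality using (Coprime)
open import Data.Nat.Divisibility using (_∣_; _∣?_; divides; ∣-trans; ∣-refl; _∣0; ∣⇒≤)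
open import Data.Nat.DivMod using (_%_; m≡m%n+[m/n]*n; m%n<n; m*n/n≡m)
open import Data.Nat.Primality using (Prime; euclidsLemma; prime⇒irreducible; ¬prime[0]; ¬prime[1])
open import Data.Integer as ℤ using (ℤ; +_)
import Data.Integer.Properties as ℤₚ
open import Data.Rational as ℚ using (ℚ; _+_; _*_; _-_; -_; 0ℚ; 1ℚ; ½; mkℚ; toℚᵘ)
import Data.Rational.Properties as ℚₚ
import Data.Rational.Unnormalised as ℚᵘ
import Data.Rational.Unnormalised.Properties as ℚᵘₚ
open import Algebra.Bundles using (CommutativeRing)
open import Algebra.Properties.CommutativeSemiring.Exp
  (CommutativeRing.commutativeSemiring ℚₚ.+-*-commutativeRing)
  using (_^_; ^-distrib-*; ^-homo-*)
open import Data.Bool using (if_then_else_)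
open import Data.Empty using (⊥-elim)
open import Data.List using (upTo)
open import Data.List.Relation.Unary.Any using (Any; any?; satisfied)
open import Data.List.Membership.Propositional using (lose)
open import Data.List.Membership.Propositional.Properties using (∈-upTo⁺)
open import Data.Product using (_×_; _,_; ∃-syntax)
open import Data.Sum using (_⊎_; inj₁; inj₂; [_,_])
open import Function using (_∘_)
open import Level using (0ℓ)
open import Relation.Nullary using (¬_; Dec)
open import Relation.Nullary.Decidable using (dec⇒maybe; dec-true; dec-false)
open import Relation.Binary.Bundles using (Setoid)
import Relation.Binary.Reasoning.Setoid as SetoidReasoning
open import Relation.Binary.PropositionalEquality
  using (_≡_; _≢_; refl; sym; trans; cong; cong₂; subst; module ≡-Reasoning)
open import Tactic.RingSolver using (solve-∀)
import Tactic.RingSolver.Core.AlmostCommutativeRing as ACR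

ℚ-ring : ACR.AlmostCommutativeRing 0ℓ 0ℓ
ℚ-ring = ACR.fromCommutativeRing ℚₚ.+-*-commutativeRing (λ x → dec⇒maybe (0ℚ ℚₚ.≟ x))

toℚᵘ-/ : ∀ i d → toℚᵘ (i ℚ./ suc d) ℚᵘ.≃ ℚᵘ.mkℚᵘ i d
toℚᵘ-/ i d = ℚₚ.toℚᵘ-fromℚᵘ (ℚᵘ.mkℚᵘ i d)

/-*-/ : ∀ i j d e → (i ℚ./ suc d) * (j ℚ./ suc e) ≡ (i ℤ.* j) ℚ./ (suc d ℕ.* suc e)
/-*-/ i j d e = ℚₚ.toℚᵘ-injective (begin
  toℚᵘ ((i ℚ./ suc d) * (j ℚ./ suc e))        ≈⟨ ℚₚ.toℚᵘ-homo-* (i ℚ./ suc d) (j ℚ./ suc e) ⟩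
  toℚᵘ (i ℚ./ suc d) ℚᵘ.* toℚᵘ (j ℚ./ suc e)  ≈⟨ ℚᵘₚ.*-cong (toℚᵘ-/ i d) (toℚᵘ-/ j e) ⟩
  ℚᵘ.mkℚᵘ (i ℤ.* j) _                         ≈⟨ toℚᵘ-/ (i ℤ.* j) _ ⟨
  toℚᵘ ((i ℤ.* j) ℚ./ (suc d ℕ.* suc e))      ∎)
  where open ℚᵘₚ.≃-Reasoning

/-+-/ : ∀ i j d e →
  (i ℚ./ suc d) + (j ℚ./ suc e) ≡ (i ℤ.* + suc e ℤ.+ j ℤ.* + suc d) ℚ./ (suc d ℕ.* suc e)
/-+-/ i j d e = ℚₚ.toℚᵘ-injective (begin
  toℚᵘ ((i ℚ./ suc d) + (j ℚ./ suc e))        ≈⟨ ℚₚ.toℚᵘ-homo-+ (i ℚ./ suc d) (j ℚ./ suc e) ⟩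
  toℚᵘ (i ℚ./ suc d) ℚᵘ.+ toℚᵘ (j ℚ./ suc e)  ≈⟨ ℚᵘₚ.+-cong (toℚᵘ-/ i d) (toℚᵘ-/ j e) ⟩
  ℚᵘ.mkℚᵘ (i ℤ.* + suc e ℤ.+ j ℤ.* + suc d) _  ≈⟨ toℚᵘ-/ _ _ ⟨
  toℚᵘ ((i ℤ.* + suc e ℤ.+ j ℤ.* + suc d) ℚ./ (suc d ℕ.* suc e)) ∎)
  where open ℚᵘₚ.≃-Reasoning

nℚ-homo-+ : ∀ a b → nℚ (a ℕ.+ b) ≡ nℚ a + nℚ b
nℚ-homo-+ a b = sym (trans (/-+-/ (+ a) (+ b) 0 0) (ℚₚ./-cong numerator refl))
  where
  numerator : + a ℤ.* + 1 ℤ.+ + b ℤ.* + 1 ≡ + (a ℕ.+ b)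
  numerator = cong₂ ℤ._+_ (ℤₚ.*-identityʳ (+ a)) (ℤₚ.*-identityʳ (+ b))

nℚ-homo-* : ∀ a b → nℚ (a ℕ.* b) ≡ nℚ a * nℚ b
nℚ-homo-* a b = sym (trans (/-*-/ (+ a) (+ b) 0 0) (ℚₚ./-cong (sym (ℤₚ.pos-* a b)) refl))

nℚ-suc : ∀ k → nℚ (suc k) ≡ nℚ k + 1ℚ
nℚ-suc k = trans (cong nℚ (ℕₚ.+-comm 1 k)) (nℚ-homo-+ k 1)

nℚ-homo-^ : ∀ a k → nℚ (a ℕ.^ k) ≡ nℚ a ^ k
nℚ-homo-^ a zero    = refl
nℚ-homo-^ a (suc k) = trans (nℚ-homo-* a (a ℕ.^ k)) (cong (nℚ a *_) (nℚ-homo-^ a k))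

nℚ-square+1 : ∀ x → nℚ (x ℕ.* x ℕ.+ 1) ≡ nℚ x * nℚ x + 1ℚ
nℚ-square+1 x = trans (nℚ-homo-+ (x ℕ.* x) 1) (cong (_+ 1ℚ) (nℚ-homo-* x x))

recip : ℕ → ℚ
recip zero    = 0ℚ
recip (suc d) = + 1 ℚ./ suc d

/≡*recip : ∀ a d .{{_ : ℕ.NonZero d}} → + a ℚ./ d ≡ nℚ a * recip d
/≡*recip a (suc d) =
  sym (trans (/-*-/ (+ a) (+ 1) 0 d) (ℚₚ./-cong (ℤₚ.*-identityʳ (+ a)) (ℕₚ.*-identityˡ (suc d))))

nℚ*recip≡1 : ∀ d .{{_ : ℕ.NonZero d}} → nℚ d * recip d ≡ 1ℚ
nℚ*recip≡1 (suc d) =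
  trans (sym (/≡*recip (suc d) (suc d))) (ℚₚ.fromℚᵘ-cong {ℚᵘ.mkℚᵘ (+ suc d) d} {ℚᵘ.mkℚᵘ (+ 1) 0}
    (ℚᵘ.*≡* (ℤₚ.*-comm (+ suc d) (+ 1))))

*nℚ≡⇒≡*recip : ∀ a b d .{{_ : ℕ.NonZero d}} → a * nℚ d ≡ b → a ≡ b * recip d
*nℚ≡⇒≡*recip a b d ad≡b = begin
  a                        ≡⟨ ℚₚ.*-identityʳ a ⟨
  a * 1ℚ                   ≡⟨ cong (a *_) (nℚ*recip≡1 d) ⟨
  a * (nℚ d * recip d)     ≡⟨ ℚₚ.*-assoc a (nℚ d) (recip d) ⟨
  a * nℚ d * recip d       ≡⟨ cong (_* recip d) ad≡b ⟩
  b * recip d              ∎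
  where open ≡-Reasoning

recip-unique : ∀ a d .{{_ : ℕ.NonZero d}} → a * nℚ d ≡ 1ℚ → a ≡ recip d
recip-unique a d a*d≡1 = trans (*nℚ≡⇒≡*recip a 1ℚ d a*d≡1) (ℚₚ.*-identityˡ (recip d))

recip-cancelˡ : ∀ d .{{_ : ℕ.NonZero d}} y → recip d * (nℚ d * y) ≡ y
recip-cancelˡ d y = begin
  recip d * (nℚ d * y)   ≡⟨ ℚₚ.*-assoc (recip d) (nℚ d) y ⟨
  recip d * nℚ d * y     ≡⟨ cong (_* y) (trans (ℚₚ.*-comm (recip d) (nℚ d)) (nℚ*recip≡1 d)) ⟩
  1ℚ * y                 ≡⟨ ℚₚ.*-identityˡ y ⟩
  y                      ∎
  where open ≡-Reasoning

cross-divide : ∀ a b d e .{{_ : ℕ.NonZero d}} .{{_ : ℕ.NonZero e}} →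
               a * nℚ d ≡ b * nℚ e → a * recip e ≡ b * recip d
cross-divide a b d e ad≡be = begin
  a * recip e                          ≡⟨ ℚₚ.*-identityʳ (a * recip e) ⟨
  a * recip e * 1ℚ                     ≡⟨ cong (a * recip e *_) (nℚ*recip≡1 d) ⟨
  a * recip e * (nℚ d * recip d)       ≡⟨ regroup a (recip e) (nℚ d) (recip d) ⟩
  a * nℚ d * recip d * recip e         ≡⟨ cong (λ u → u * recip d * recip e) ad≡be ⟩
  b * nℚ e * recip d * recip e         ≡⟨ swap (b * nℚ e) (recip d) (recip e) ⟩
  b * nℚ e * recip e * recip d         ≡⟨ regroup b (recip d) (nℚ e) (recip e) ⟨
  b * recip d * (nℚ e * recip e)       ≡⟨ cong (b * recip d *_) (nℚ*recip≡1 e) ⟩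
  b * recip d * 1ℚ                     ≡⟨ ℚₚ.*-identityʳ (b * recip d) ⟩
  b * recip d                          ∎
  where
  open ≡-Reasoning
  regroup : ∀ a r N s → a * r * (N * s) ≡ a * N * s * r
  regroup = solve-∀ ℚ-ring
  swap : ∀ a r s → a * r * s ≡ a * s * r
  swap = solve-∀ ℚ-ring

1^k≡1 : ∀ k → 1ℚ ^ k ≡ 1ℚ
1^k≡1 zero    = refl
1^k≡1 (suc k) = trans (ℚₚ.*-identityˡ (1ℚ ^ k)) (1^k≡1 k)

recip-2^ : ∀ k → recip (2 ℕ.^ k) ≡ ½ ^ k
recip-2^ k = sym (recip-unique (½ ^ k) (2 ℕ.^ k) {{ℕₚ.m^n≢0 2 k}} (begin
  ½ ^ k * nℚ (2 ℕ.^ k)  ≡⟨ cong (½ ^ k *_) (nℚ-homo-^ 2 k) ⟩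
  ½ ^ k * nℚ 2 ^ k      ≡⟨ ^-distrib-* ½ (nℚ 2) k ⟨
  1ℚ ^ k                ≡⟨ 1^k≡1 k ⟩
  1ℚ                    ∎))
  where open ≡-Reasoning

^-double : ∀ x n → x ^ (n ℕ.+ n) ≡ (x * x) ^ n
^-double x n = trans (^-homo-* x n n) (sym (^-distrib-* x x n))

[-1]^[n+n]≡1 : ∀ n → (- 1ℚ) ^ (n ℕ.+ n) ≡ 1ℚ
[-1]^[n+n]≡1 n = trans (^-double (- 1ℚ) n) (1^k≡1 n)

[-1]^[1+n+n]≡-1 : ∀ n → (- 1ℚ) ^ suc (n ℕ.+ n) ≡ - 1ℚ
[-1]^[1+n+n]≡-1 n = trans (cong (- 1ℚ *_) ([-1]^[n+n]≡1 n)) (ℚₚ.*-identityʳ (- 1ℚ))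

0^n≡0 : ∀ n → n ≢ 0 → 0ℚ ^ n ≡ 0ℚ
0^n≡0 zero    n≢0 = ⊥-elim (n≢0 refl)
0^n≡0 (suc n) _   = ℚₚ.*-zeroˡ (0ℚ ^ n)

sumTo : ℕ → (ℕ → ℚ) → ℚ
sumTo zero    f = f 0
sumTo (suc n) f = sumTo n f + f (suc n)

sumTo-cong : ∀ n {f g : ℕ → ℚ} → (∀ k → k ≤ n → f k ≡ g k) → sumTo n f ≡ sumTo n g
sumTo-cong zero    f≡g = f≡g 0 z≤n
sumTo-cong (suc n) f≡g =
  cong₂ _+_ (sumTo-cong n (λ k k≤n → f≡g k (ℕₚ.m≤n⇒m≤1+n k≤n))) (f≡g (suc n) ℕₚ.≤-refl)

sumTo-distrib-+ : ∀ n (f g : ℕ → ℚ) → sumTo n (λ k → f k + g k) ≡ sumTo n f + sumTo n g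
sumTo-distrib-+ zero    f g = refl
sumTo-distrib-+ (suc n) f g =
  trans (cong (_+ (f (suc n) + g (suc n))) (sumTo-distrib-+ n f g))
        (swap (sumTo n f) (sumTo n g) (f (suc n)) (g (suc n)))
  where
  swap : ∀ a b c d → (a + b) + (c + d) ≡ (a + c) + (b + d)
  swap = solve-∀ ℚ-ring

*-distribˡ-sumTo : ∀ n c (f : ℕ → ℚ) → sumTo n (λ k → c * f k) ≡ c * sumTo n f
*-distribˡ-sumTo zero    c f = refl
*-distribˡ-sumTo (suc n) c f =
  trans (cong (_+ c * f (suc n)) (*-distribˡ-sumTo n c f))
        (sym (ℚₚ.*-distribˡ-+ c (sumTo n f) (f (suc n))))

sumTo-neg : ∀ n (f : ℕ → ℚ) → sumTo n (λ k → - f k) ≡ - sumTo n f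
sumTo-neg zero    f = refl
sumTo-neg (suc n) f =
  trans (cong (_+ - f (suc n)) (sumTo-neg n f)) (sym (ℚₚ.neg-distrib-+ (sumTo n f) (f (suc n))))

sumTo-unfoldˡ : ∀ n (f : ℕ → ℚ) → sumTo (suc n) f ≡ f 0 + sumTo n (λ k → f (suc k))
sumTo-unfoldˡ zero    f = refl
sumTo-unfoldˡ (suc n) f =
  trans (cong (_+ f (suc (suc n))) (sumTo-unfoldˡ n f)) (ℚₚ.+-assoc (f 0) _ _)

sumTo-shift : ∀ n (f : ℕ → ℚ) → sumTo n (λ k → f (suc k)) ≡ sumTo n f + f (suc n) - f 0
sumTo-shift n f = begin
  sumTo n (λ k → f (suc k))              ≡⟨ cancel (f 0) _ ⟩
  f 0 + sumTo n (λ k → f (suc k)) - f 0  ≡⟨ cong (_- f 0) (sumTo-unfoldˡ n f) ⟨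
  sumTo n f + f (suc n) - f 0            ∎
  where
  open ≡-Reasoning
  cancel : ∀ a s → s ≡ a + s - a
  cancel = solve-∀ ℚ-ring

sumTo≡f0+sumFrom1 : ∀ n (f : ℕ → ℚ) → sumTo n f ≡ f 0 + sumFrom1 n f
sumTo≡f0+sumFrom1 zero    f = sym (ℚₚ.+-identityʳ (f 0))
sumTo≡f0+sumFrom1 (suc n) f =
  trans (cong (_+ f (suc n)) (sumTo≡f0+sumFrom1 n f)) (ℚₚ.+-assoc (f 0) _ _)

sumFrom1-cong : ∀ n {f g : ℕ → ℚ} → (∀ k → f k ≡ g k) → sumFrom1 n f ≡ sumFrom1 n g
sumFrom1-cong zero    f≡g = refl
sumFrom1-cong (suc n) f≡g = cong₂ _+_ (sumFrom1-cong n f≡g) (f≡g (suc n))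

positiveIndicator : ℕ → ℚ
positiveIndicator zero    = 0ℚ
positiveIndicator (suc _) = 1ℚ

sumTo-positiveIndicator : ∀ n → sumTo n positiveIndicator ≡ nℚ n
sumTo-positiveIndicator zero    = refl
sumTo-positiveIndicator (suc n) = trans (cong (_+ 1ℚ) (sumTo-positiveIndicator n)) (sym (nℚ-suc n))

-- Binomial coefficients

binom : ℕ → ℕ → ℚ
binom n       zero    = 1ℚ
binom zero    (suc k) = 0ℚ
binom (suc n) (suc k) = binom n k + binom n (suc k)

nℚ-C≡binom : ∀ n k → nℚ (n C k) ≡ binom n k
nℚ-C≡binom n       zero    = refl
nℚ-C≡binom zero    (suc k) = refl
nℚ-C≡binom (suc n) (suc k) = begin
  nℚ (suc n C suc k)               ≡⟨ cong nℚ (nCk+nC[k+1]≡[n+1]C[k+1] n k) ⟨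
  nℚ (n C k ℕ.+ n C suc k)         ≡⟨ nℚ-homo-+ (n C k) (n C suc k) ⟩
  nℚ (n C k) + nℚ (n C suc k)      ≡⟨ cong₂ _+_ (nℚ-C≡binom n k) (nℚ-C≡binom n (suc k)) ⟩
  binom n k + binom n (suc k)      ∎
  where open ≡-Reasoning

binom-above : ∀ n k → n < k → binom n k ≡ 0ℚ
binom-above zero    (suc k) _         = refl
binom-above (suc n) (suc k) (s≤s n<k) =
  cong₂ _+_ (binom-above n k n<k) (binom-above n (suc k) (ℕₚ.m≤n⇒m≤1+n n<k))

binom-diag : ∀ n → binom n n ≡ 1ℚ
binom-diag zero    = refl
binom-diag (suc n) =
  trans (cong₂ _+_ (binom-diag n) (binom-above n (suc n) ℕₚ.≤-refl)) (ℚₚ.+-identityʳ 1ℚ)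

binom-1 : ∀ n → binom n 1 ≡ nℚ n
binom-1 zero    = refl
binom-1 (suc n) = trans (cong (_+_ 1ℚ) (binom-1 n)) (trans (ℚₚ.+-comm 1ℚ (nℚ n)) (sym (nℚ-suc n)))

binom-absorption : ∀ n k → binom (suc n) (suc k) * nℚ (suc k) ≡ nℚ (suc n) * binom n k
binom-absorption n       zero    = trans (ℚₚ.*-identityʳ _) (trans (binom-1 (suc n)) (sym (ℚₚ.*-identityʳ _)))
binom-absorption zero    (suc k) = trans (ℚₚ.*-zeroˡ (nℚ (suc (suc k)))) (sym (ℚₚ.*-zeroʳ 1ℚ))
binom-absorption (suc n) (suc k) = begin
  (b₁ + b₂) * nℚ (suc (suc k))   ≡⟨ cong ((b₁ + b₂) *_) (nℚ-suc (suc k)) ⟩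
  (b₁ + b₂) * (K + 1ℚ)           ≡⟨ expand b₁ b₂ K ⟩
  b₁ * K + b₁ + b₂ * (K + 1ℚ)    ≡⟨ cong₂ (λ u v → u + b₁ + v) (binom-absorption n k)
                                     (trans (cong (b₂ *_) (sym (nℚ-suc (suc k)))) (binom-absorption n (suc k))) ⟩
  N * c₀ + (c₀ + c₁) + N * c₁    ≡⟨ collect N c₀ c₁ ⟩
  (N + 1ℚ) * (c₀ + c₁)           ≡⟨ cong (_* (c₀ + c₁)) (nℚ-suc (suc n)) ⟨
  nℚ (suc (suc n)) * (c₀ + c₁)   ∎
  where
  open ≡-Reasoning
  b₁ = binom (suc n) (suc k)
  b₂ = binom (suc n) (suc (suc k))
  c₀ = binom n k
  c₁ = binom n (suc k)
  K = nℚ (suc k)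
  N = nℚ (suc n)
  expand : ∀ b₁ b₂ K → (b₁ + b₂) * (K + 1ℚ) ≡ b₁ * K + b₁ + b₂ * (K + 1ℚ)
  expand = solve-∀ ℚ-ring
  collect : ∀ N c₀ c₁ → N * c₀ + (c₀ + c₁) + N * c₁ ≡ (N + 1ℚ) * (c₀ + c₁)
  collect = solve-∀ ℚ-ring

nℚ-∸-split : ∀ n j → j ≤ n → nℚ (n ℕ.∸ j) + nℚ (suc j) ≡ nℚ (suc n)
nℚ-∸-split n j j≤n = trans (sym (nℚ-homo-+ (n ℕ.∸ j) (suc j))) (cong nℚ (begin
  n ℕ.∸ j ℕ.+ suc j    ≡⟨ ℕₚ.+-suc (n ℕ.∸ j) j ⟩
  suc (n ℕ.∸ j ℕ.+ j)  ≡⟨ cong suc (ℕₚ.m∸n+n≡m j≤n) ⟩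
  suc n                ∎))
  where open ≡-Reasoning

binom-suc-ratio : ∀ n j → j ≤ n → binom n (suc j) * nℚ (suc j) ≡ binom n j * nℚ (n ℕ.∸ j)
binom-suc-complement : ∀ n k → k ≤ n → binom (suc n) k * nℚ (suc n ℕ.∸ k) ≡ binom n k * nℚ (suc n)

binom-suc-ratio zero    zero    _ = refl
binom-suc-ratio (suc n) j       j≤1+n with ℕₚ.m≤n⇒m<n∨m≡n j≤1+n
... | inj₁ (s≤s j≤n) = begin
  binom (suc n) (suc j) * nℚ (suc j)  ≡⟨ binom-absorption n j ⟩
  nℚ (suc n) * binom n j              ≡⟨ ℚₚ.*-comm (nℚ (suc n)) (binom n j) ⟩
  binom n j * nℚ (suc n)              ≡⟨ binom-suc-complement n j j≤n ⟨
  binom (suc n) j * nℚ (suc n ℕ.∸ j)  ∎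
  where open ≡-Reasoning
... | inj₂ refl = begin
  binom (suc n) (suc (suc n)) * nℚ (suc (suc n))  ≡⟨ cong (_* nℚ (suc (suc n))) (binom-above (suc n) (suc (suc n)) ℕₚ.≤-refl) ⟩
  0ℚ * nℚ (suc (suc n))                          ≡⟨ ℚₚ.*-zeroˡ (nℚ (suc (suc n))) ⟩
  0ℚ                                             ≡⟨ ℚₚ.*-zeroʳ (binom (suc n) (suc n)) ⟨
  binom (suc n) (suc n) * 0ℚ                     ≡⟨ cong (λ m → binom (suc n) (suc n) * nℚ m) (ℕₚ.n∸n≡0 n) ⟨
  binom (suc n) (suc n) * nℚ (n ℕ.∸ n)           ∎
  where open ≡-Reasoning

binom-suc-complement n zero    _     = refl
binom-suc-complement n (suc j) 1+j≤n = begin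
  (binom n j + b) * nℚ (n ℕ.∸ j)                ≡⟨ ℚₚ.*-distribʳ-+ (nℚ (n ℕ.∸ j)) (binom n j) b ⟩
  binom n j * nℚ (n ℕ.∸ j) + b * nℚ (n ℕ.∸ j)   ≡⟨ cong (_+ b * nℚ (n ℕ.∸ j)) (binom-suc-ratio n j j≤n) ⟨
  b * nℚ (suc j) + b * nℚ (n ℕ.∸ j)             ≡⟨ ℚₚ.*-distribˡ-+ b (nℚ (suc j)) (nℚ (n ℕ.∸ j)) ⟨
  b * (nℚ (suc j) + nℚ (n ℕ.∸ j))               ≡⟨ cong (b *_) (trans (ℚₚ.+-comm (nℚ (suc j)) (nℚ (n ℕ.∸ j))) (nℚ-∸-split n j j≤n)) ⟩
  b * nℚ (suc n)                                ∎
  where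
  open ≡-Reasoning
  b = binom n (suc j)
  j≤n = ℕₚ.<⇒≤ 1+j≤n

binom-recip-complement : ∀ n k → k ≤ n →
  binom n k * recip (suc (n ℕ.∸ k)) ≡ recip (suc n) * binom (suc n) k
binom-recip-complement n k k≤n = begin
  binom n k * recip (suc (n ℕ.∸ k))  ≡⟨ cross-divide (binom (suc n) k) (binom n k) (suc (n ℕ.∸ k)) (suc n) complement ⟨
  binom (suc n) k * recip (suc n)    ≡⟨ ℚₚ.*-comm (binom (suc n) k) (recip (suc n)) ⟩
  recip (suc n) * binom (suc n) k    ∎
  where
  open ≡-Reasoning
  complement : binom (suc n) k * nℚ (suc (n ℕ.∸ k)) ≡ binom n k * nℚ (suc n)
  complement = subst (λ m → binom (suc n) k * nℚ m ≡ binom n k * nℚ (suc n))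
                     (ℕₚ.+-∸-assoc 1 k≤n) (binom-suc-complement n k k≤n)

binomial-theorem : ∀ x n → sumTo n (λ k → binom n k * x ^ k) ≡ (1ℚ + x) ^ n
binomial-theorem x zero    = refl
binomial-theorem x (suc n) = begin
  sumTo (suc n) F                                     ≡⟨ sumTo-unfoldˡ n F ⟩
  F 0 + sumTo n (λ j → F (suc j))                     ≡⟨ cong (_+_ 1ℚ) (sumTo-cong n (λ j _ → pascal j)) ⟩
  1ℚ + sumTo n (λ j → x * G j + G (suc j))            ≡⟨ cong (_+_ 1ℚ) (sumTo-distrib-+ n (λ j → x * G j) (λ j → G (suc j))) ⟩
  1ℚ + (sumTo n (λ j → x * G j) + sumTo n (λ j → G (suc j)))
    ≡⟨ cong₂ (λ u v → 1ℚ + (u + v)) (*-distribˡ-sumTo n x G) (sumTo-shift n G) ⟩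
  1ℚ + (x * S + (S + G (suc n) - 1ℚ))                 ≡⟨ cong (λ u → 1ℚ + (x * S + (S + u - 1ℚ))) G[1+n]≡0 ⟩
  1ℚ + (x * S + (S + 0ℚ - 1ℚ))                        ≡⟨ collect x S ⟩
  (1ℚ + x) * S                                        ≡⟨ cong ((1ℚ + x) *_) (binomial-theorem x n) ⟩
  (1ℚ + x) * (1ℚ + x) ^ n                             ∎
  where
  open ≡-Reasoning
  F = λ k → binom (suc n) k * x ^ k
  G = λ k → binom n k * x ^ k
  S = sumTo n G
  pascal : ∀ j → F (suc j) ≡ x * G j + G (suc j)
  pascal j = distrib (binom n j) (binom n (suc j)) x (x ^ j)
    where
    distrib : ∀ a b x y → (a + b) * (x * y) ≡ x * (a * y) + b * (x * y)
    distrib = solve-∀ ℚ-ring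
  G[1+n]≡0 : G (suc n) ≡ 0ℚ
  G[1+n]≡0 = trans (cong (_* x ^ suc n) (binom-above n (suc n) ℕₚ.≤-refl)) (ℚₚ.*-zeroˡ (x ^ suc n))
  collect : ∀ x S → 1ℚ + (x * S + (S + 0ℚ - 1ℚ)) ≡ (1ℚ + x) * S
  collect = solve-∀ ℚ-ring

centralTerm : ℕ → ℚ
centralTerm k = binom (2 ℕ.* k) k * ½ ^ k

termA≡centralTerm : ∀ k → termA k ≡ centralTerm k
termA≡centralTerm k = trans (/≡*recip ((2 ℕ.* k) C k) (2 ℕ.^ k) {{ℕₚ.m^n≢0 2 k}})
                            (cong₂ _*_ (nℚ-C≡binom (2 ℕ.* k) k) (recip-2^ k))

central-binom-suc : ∀ k → binom (2 ℕ.* suc k) (suc k) * nℚ (suc k) ≡ nℚ 2 * (binom (2 ℕ.* k) k * nℚ (suc (2 ℕ.* k)))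
central-binom-suc k = begin
  binom (2 ℕ.* suc k) (suc k) * nℚ (suc k)        ≡⟨ cong (λ j → binom j (suc k) * nℚ (suc k)) (ℕₚ.*-suc 2 k) ⟩
  binom (suc (suc (2 ℕ.* k))) (suc k) * nℚ (suc k) ≡⟨ binom-absorption (suc (2 ℕ.* k)) k ⟩
  nℚ (2 ℕ.+ 2 ℕ.* k) * b                           ≡⟨ cong (λ j → nℚ j * b) (ℕₚ.*-suc 2 k) ⟨
  nℚ (2 ℕ.* suc k) * b                             ≡⟨ cong (_* b) (nℚ-homo-* 2 (suc k)) ⟩
  nℚ 2 * nℚ (suc k) * b                            ≡⟨ swap (nℚ 2) (nℚ (suc k)) b ⟩
  nℚ 2 * (b * nℚ (suc k))                          ≡⟨ cong (λ j → nℚ 2 * (b * nℚ j)) [2k+1]∸k≡k+1 ⟨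
  nℚ 2 * (b * nℚ (suc (2 ℕ.* k) ℕ.∸ k))            ≡⟨ cong (nℚ 2 *_) (binom-suc-complement (2 ℕ.* k) k (ℕₚ.m≤n*m k 2)) ⟩
  nℚ 2 * (binom (2 ℕ.* k) k * nℚ (suc (2 ℕ.* k)))  ∎
  where
  open ≡-Reasoning
  b = binom (suc (2 ℕ.* k)) k
  swap : ∀ t K b → t * K * b ≡ t * (b * K)
  swap = solve-∀ ℚ-ring
  [2k+1]∸k≡k+1 : suc (2 ℕ.* k) ℕ.∸ k ≡ suc k
  [2k+1]∸k≡k+1 = begin
    suc (2 ℕ.* k) ℕ.∸ k        ≡⟨ ℕₚ.+-∸-assoc 1 (ℕₚ.m≤n*m k 2) ⟩
    suc (k ℕ.+ (k ℕ.+ 0) ℕ.∸ k) ≡⟨ cong suc (ℕₚ.m+n∸m≡n k (k ℕ.+ 0)) ⟩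
    suc (k ℕ.+ 0)               ≡⟨ cong suc (ℕₚ.+-identityʳ k) ⟩
    suc k                       ∎

centralTerm-suc : ∀ k → centralTerm (suc k) * nℚ (suc k) ≡ nℚ (suc (2 ℕ.* k)) * centralTerm k
centralTerm-suc k = begin
  b′ * (½ * ½ ^ k) * nℚ (suc k)                   ≡⟨ regroup b′ (½ ^ k) (nℚ (suc k)) ⟩
  ½ * (b′ * nℚ (suc k)) * ½ ^ k                   ≡⟨ cong (λ u → ½ * u * ½ ^ k) (central-binom-suc k) ⟩
  ½ * (nℚ 2 * (b * nℚ (suc (2 ℕ.* k)))) * ½ ^ k   ≡⟨ halve b (nℚ (suc (2 ℕ.* k))) (½ ^ k) ⟩
  nℚ (suc (2 ℕ.* k)) * (b * ½ ^ k)                ∎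
  where
  open ≡-Reasoning
  b′ = binom (2 ℕ.* suc k) (suc k)
  b = binom (2 ℕ.* k) k
  regroup : ∀ b w K → b * (½ * w) * K ≡ ½ * (b * K) * w
  regroup = solve-∀ ℚ-ring
  halve : ∀ b N w → ½ * (nℚ 2 * (b * N)) * w ≡ N * (b * w)
  halve = solve-∀ ℚ-ring

-- Harmonic numbers

harmonic : ℕ → ℚ
harmonic m = sumFrom1 m recip

harmonicGap : ℕ → ℕ → ℚ
harmonicGap n k = harmonic n - harmonic (n ℕ.∸ k)

harmonicGap-zero : ∀ n → harmonicGap n 0 ≡ 0ℚ
harmonicGap-zero n = ℚₚ.+-inverseʳ (harmonic n)

harmonicGap-suc-suc : ∀ n j → harmonicGap (suc n) (suc j) ≡ recip (suc n) + harmonicGap n j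
harmonicGap-suc-suc n j = regroup (harmonic n) (recip (suc n)) (harmonic (n ℕ.∸ j))
  where
  regroup : ∀ h r t → (h + r) - t ≡ r + (h - t)
  regroup = solve-∀ ℚ-ring

harmonicGap-sucˡ : ∀ n k → k ≤ n →
  harmonicGap (suc n) k ≡ harmonicGap n k + recip (suc n) - recip (suc (n ℕ.∸ k))
harmonicGap-sucˡ n k k≤n rewrite ℕₚ.+-∸-assoc 1 k≤n =
  regroup (harmonic n) (recip (suc n)) (harmonic (n ℕ.∸ k)) (recip (suc (n ℕ.∸ k)))
  where
  regroup : ∀ h r t s → (h + r) - (t + s) ≡ (h - t) + r - s
  regroup = solve-∀ ℚ-ring

harmonicGap-sucʳ : ∀ n k → k < n → harmonicGap n (suc k) ≡ harmonicGap n k + recip (n ℕ.∸ k)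
harmonicGap-sucʳ n k k<n rewrite ℕₚ.+-∸-assoc 1 k<n =
  regroup (harmonic n) (harmonic (n ℕ.∸ suc k)) (recip (suc (n ℕ.∸ suc k)))
  where
  regroup : ∀ h t s → h - t ≡ h - (t + s) + s
  regroup = solve-∀ ℚ-ring

binomialHarmonicSum : ℚ → ℕ → ℚ
binomialHarmonicSum x n = sumTo n (λ k → binom n k * x ^ k * harmonicGap n k)

module _ (x : ℚ) where

  private
    term : ℕ → ℕ → ℚ
    term n k = binom n k * x ^ k

    W = binomialHarmonicSum x

  shifted-gap-sum : ∀ n → sumTo n (λ k → term n k * harmonicGap (suc n) k) ≡
    W n + recip (suc n) * sumTo n (term n) - sumTo n (λ k → term n k * recip (suc (n ℕ.∸ k)))
  shifted-gap-sum n = begin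
    sumTo n (λ k → t k * harmonicGap (suc n) k)
      ≡⟨ sumTo-cong n (λ k k≤n → trans (cong (t k *_) (harmonicGap-sucˡ n k k≤n))
                                       (distrib (t k) (harmonicGap n k) (recip (suc n)) (c k))) ⟩
    sumTo n (λ k → t k * harmonicGap n k + r * t k + - (t k * c k))
      ≡⟨ sumTo-distrib-+ n (λ k → t k * harmonicGap n k + r * t k) (λ k → - (t k * c k)) ⟩
    sumTo n (λ k → t k * harmonicGap n k + r * t k) + sumTo n (λ k → - (t k * c k))
      ≡⟨ cong₂ _+_ (sumTo-distrib-+ n (λ k → t k * harmonicGap n k) (λ k → r * t k))
                   (sumTo-neg n (λ k → t k * c k)) ⟩
    W n + sumTo n (λ k → r * t k) - sumTo n (λ k → t k * c k)
      ≡⟨ cong (λ u → W n + u - sumTo n (λ k → t k * c k)) (*-distribˡ-sumTo n r t) ⟩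
    W n + r * sumTo n t - sumTo n (λ k → t k * c k) ∎
    where
    open ≡-Reasoning
    t = term n
    r = recip (suc n)
    c = λ k → recip (suc (n ℕ.∸ k))
    distrib : ∀ a g r c → a * (g + r - c) ≡ a * g + r * a + - (a * c)
    distrib = solve-∀ ℚ-ring

  complement-sum : ∀ n → sumTo n (λ k → term n k * recip (suc (n ℕ.∸ k))) ≡
                         recip (suc n) * ((1ℚ + x) ^ suc n - x ^ suc n)
  complement-sum n = begin
    sumTo n (λ k → term n k * recip (suc (n ℕ.∸ k)))
      ≡⟨ sumTo-cong n (λ k k≤n → trans (swap (binom n k) (x ^ k) (recip (suc (n ℕ.∸ k))))
                                 (trans (cong (_* x ^ k) (binom-recip-complement n k k≤n))
                                        (ℚₚ.*-assoc r (binom (suc n) k) (x ^ k)))) ⟩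
    sumTo n (λ k → r * term (suc n) k)          ≡⟨ *-distribˡ-sumTo n r (term (suc n)) ⟩
    r * sumTo n (term (suc n))                  ≡⟨ cong (r *_) (add-sub (sumTo n (term (suc n))) (term (suc n) (suc n))) ⟩
    r * (sumTo (suc n) (term (suc n)) - term (suc n) (suc n))
      ≡⟨ cong₂ (λ u v → r * (u - v * x ^ suc n)) (binomial-theorem x (suc n)) (binom-diag (suc n)) ⟩
    r * ((1ℚ + x) ^ suc n - 1ℚ * x ^ suc n)     ≡⟨ cong (λ u → r * ((1ℚ + x) ^ suc n - u)) (ℚₚ.*-identityˡ (x ^ suc n)) ⟩
    r * ((1ℚ + x) ^ suc n - x ^ suc n)          ∎
    where
    open ≡-Reasoning
    r = recip (suc n)
    swap : ∀ a y c → a * y * c ≡ a * c * y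
    swap = solve-∀ ℚ-ring
    add-sub : ∀ s f → s ≡ s + f - f
    add-sub = solve-∀ ℚ-ring

  gap-pascal : ∀ n j → term (suc n) (suc j) * harmonicGap (suc n) (suc j) ≡
    x * recip (suc n) * term n j + x * (term n j * harmonicGap n j) + term n (suc j) * harmonicGap (suc n) (suc j)
  gap-pascal n j = begin
    (a + b) * (x * y) * c                 ≡⟨ split a b (x * y) c ⟩
    a * (x * y) * c + b * (x * y) * c     ≡⟨ cong (λ u → a * (x * y) * u + b * (x * y) * c) (harmonicGap-suc-suc n j) ⟩
    a * (x * y) * (r + g) + b * (x * y) * c
      ≡⟨ cong (_+ b * (x * y) * c) (expand a x y r g) ⟩
    x * r * (a * y) + x * (a * y * g) + b * (x * y) * c ∎
    where
    open ≡-Reasoning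
    a = binom n j
    b = binom n (suc j)
    y = x ^ j
    r = recip (suc n)
    c = harmonicGap (suc n) (suc j)
    g = harmonicGap n j
    split : ∀ a b z c → (a + b) * z * c ≡ a * z * c + b * z * c
    split = solve-∀ ℚ-ring
    expand : ∀ a x y r g → a * (x * y) * (r + g) ≡ x * r * (a * y) + x * (a * y * g)
    expand = solve-∀ ℚ-ring

  binomialHarmonicSum-unfold : ∀ n → W (suc n) ≡
    x * recip (suc n) * sumTo n (term n) + x * W n + sumTo n (λ k → term n k * harmonicGap (suc n) k)
  binomialHarmonicSum-unfold n = begin
    sumTo (suc n) F                                             ≡⟨ sumTo-unfoldˡ n F ⟩
    F 0 + sumTo n (λ j → F (suc j))                             ≡⟨ cong₂ _+_ F[0]≡0 (sumTo-cong n (λ j _ → gap-pascal n j)) ⟩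
    0ℚ + sumTo n (λ j → x * r * t j + x * w j + G (suc j))      ≡⟨ ℚₚ.+-identityˡ _ ⟩
    sumTo n (λ j → x * r * t j + x * w j + G (suc j))
      ≡⟨ sumTo-distrib-+ n (λ j → x * r * t j + x * w j) (λ j → G (suc j)) ⟩
    sumTo n (λ j → x * r * t j + x * w j) + sumTo n (λ j → G (suc j))
      ≡⟨ cong₂ _+_ (sumTo-distrib-+ n (λ j → x * r * t j) (λ j → x * w j)) (sumTo-shift n G) ⟩
    sumTo n (λ j → x * r * t j) + sumTo n (λ j → x * w j) + (sumTo n G + G (suc n) - G 0)
      ≡⟨ cong₂ (λ u v → u + v + (sumTo n G + G (suc n) - G 0))
               (*-distribˡ-sumTo n (x * r) t) (*-distribˡ-sumTo n x w) ⟩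
    x * r * sumTo n t + x * W n + (sumTo n G + G (suc n) - G 0)
      ≡⟨ cong₂ (λ u v → x * r * sumTo n t + x * W n + (sumTo n G + u - v)) G[1+n]≡0 G[0]≡0 ⟩
    x * r * sumTo n t + x * W n + (sumTo n G + 0ℚ - 0ℚ)
      ≡⟨ cong (_+_ (x * r * sumTo n t + x * W n)) (+0-0 (sumTo n G)) ⟩
    x * r * sumTo n t + x * W n + sumTo n G ∎
    where
    open ≡-Reasoning
    r = recip (suc n)
    t = term n
    w = λ j → t j * harmonicGap n j
    F = λ j → term (suc n) j * harmonicGap (suc n) j
    G = λ j → t j * harmonicGap (suc n) j
    F[0]≡0 : F 0 ≡ 0ℚ
    F[0]≡0 = trans (cong (term (suc n) 0 *_) (harmonicGap-zero (suc n))) (ℚₚ.*-zeroʳ (term (suc n) 0))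
    G[0]≡0 : G 0 ≡ 0ℚ
    G[0]≡0 = trans (cong (t 0 *_) (harmonicGap-zero (suc n))) (ℚₚ.*-zeroʳ (t 0))
    G[1+n]≡0 : G (suc n) ≡ 0ℚ
    G[1+n]≡0 = begin
      binom n (suc n) * x ^ suc n * harmonicGap (suc n) (suc n)
        ≡⟨ cong (λ b → b * x ^ suc n * harmonicGap (suc n) (suc n)) (binom-above n (suc n) ℕₚ.≤-refl) ⟩
      0ℚ * x ^ suc n * harmonicGap (suc n) (suc n)
        ≡⟨ cong (_* harmonicGap (suc n) (suc n)) (ℚₚ.*-zeroˡ (x ^ suc n)) ⟩
      0ℚ * harmonicGap (suc n) (suc n)  ≡⟨ ℚₚ.*-zeroˡ (harmonicGap (suc n) (suc n)) ⟩
      0ℚ                                ∎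
    +0-0 : ∀ s → s + 0ℚ - 0ℚ ≡ s
    +0-0 = solve-∀ ℚ-ring

  binomialHarmonicSum-suc : ∀ n → W (suc n) ≡ (1ℚ + x) * W n + recip (suc n) * x ^ suc n
  binomialHarmonicSum-suc n = begin
    W (suc n)                                                    ≡⟨ binomialHarmonicSum-unfold n ⟩
    x * r * S + x * W n + sumTo n (λ k → term n k * harmonicGap (suc n) k)
      ≡⟨ cong (_+_ (x * r * S + x * W n)) (shifted-gap-sum n) ⟩
    x * r * S + x * W n + (W n + r * S - T)
      ≡⟨ cong (λ u → x * r * u + x * W n + (W n + r * u - T)) (binomial-theorem x n) ⟩
    x * r * B + x * W n + (W n + r * B - T)
      ≡⟨ cong (λ u → x * r * B + x * W n + (W n + r * B - u)) (complement-sum n) ⟩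
    x * r * B + x * W n + (W n + r * B - r * ((1ℚ + x) * B - x ^ suc n))
      ≡⟨ collect x r B (W n) (x ^ suc n) ⟩
    (1ℚ + x) * W n + r * x ^ suc n                              ∎
    where
    open ≡-Reasoning
    r = recip (suc n)
    S = sumTo n (term n)
    B = (1ℚ + x) ^ n
    T = sumTo n (λ k → term n k * recip (suc (n ℕ.∸ k)))
    collect : ∀ x r B W X → x * r * B + x * W + (W + r * B - r * ((1ℚ + x) * B - X)) ≡ (1ℚ + x) * W + r * X
    collect = solve-∀ ℚ-ring

binomialHarmonicSum-at-minus-two : ∀ n → binomialHarmonicSum (- nℚ 2) n ≡ (- 1ℚ) ^ n * sumFrom1 n termB
binomialHarmonicSum-at-minus-two zero    = refl
binomialHarmonicSum-at-minus-two (suc n) = begin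
  binomialHarmonicSum (- nℚ 2) (suc n)                    ≡⟨ binomialHarmonicSum-suc (- nℚ 2) n ⟩
  - 1ℚ * binomialHarmonicSum (- nℚ 2) n + r * (- nℚ 2) ^ suc n
    ≡⟨ cong₂ (λ u v → - 1ℚ * u + r * v) (binomialHarmonicSum-at-minus-two n) (^-distrib-* (- 1ℚ) (nℚ 2) (suc n)) ⟩
  - 1ℚ * (L * B) + r * ((- 1ℚ) ^ suc n * nℚ 2 ^ suc n)
    ≡⟨ cong (λ u → - 1ℚ * (L * B) + r * ((- 1ℚ) ^ suc n * u)) (nℚ-homo-^ 2 (suc n)) ⟨
  - 1ℚ * (L * B) + r * (- 1ℚ * L * T)                    ≡⟨ collect L B r T ⟩
  - 1ℚ * L * (B + T * r)                                 ≡⟨ cong (λ u → - 1ℚ * L * (B + u)) (/≡*recip (2 ℕ.^ suc n) (suc n)) ⟨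
  (- 1ℚ) ^ suc n * (B + termB (suc n))                   ∎
  where
  open ≡-Reasoning
  L = (- 1ℚ) ^ n
  B = sumFrom1 n termB
  r = recip (suc n)
  T = nℚ (2 ℕ.^ suc n)
  collect : ∀ L B r T → - 1ℚ * (L * B) + r * (- 1ℚ * L * T) ≡ - 1ℚ * L * (B + T * r)
  collect = solve-∀ ℚ-ring

-- Finite differences and factorials

alternatingPowerSum : ℕ → ℕ → ℕ → ℚ
alternatingPowerSum m j s = sumTo m (λ k → (- 1ℚ) ^ k * binom m k * nℚ (k ℕ.+ s) ^ j)

alternatingTerm-absorption : ∀ m j s k →
  (- 1ℚ) ^ suc k * binom (suc m) (suc k) * nℚ (suc k) * nℚ (suc k ℕ.+ s) ^ j ≡
  - nℚ (suc m) * ((- 1ℚ) ^ k * binom m k * nℚ (k ℕ.+ suc s) ^ j)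
alternatingTerm-absorption m j s k = begin
  - 1ℚ * e * binom (suc m) (suc k) * nℚ (suc k) * nℚ (suc k ℕ.+ s) ^ j
    ≡⟨ regroup e (binom (suc m) (suc k)) (nℚ (suc k)) (nℚ (suc k ℕ.+ s) ^ j) ⟩
  - 1ℚ * e * (binom (suc m) (suc k) * nℚ (suc k)) * nℚ (suc k ℕ.+ s) ^ j
    ≡⟨ cong₂ (λ u v → - 1ℚ * e * u * nℚ v ^ j) (binom-absorption m k) (sym (ℕₚ.+-suc k s)) ⟩
  - 1ℚ * e * (nℚ (suc m) * binom m k) * nℚ (k ℕ.+ suc s) ^ j
    ≡⟨ collect e (nℚ (suc m)) (binom m k) (nℚ (k ℕ.+ suc s) ^ j) ⟩
  - nℚ (suc m) * (e * binom m k * nℚ (k ℕ.+ suc s) ^ j) ∎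
  where
  open ≡-Reasoning
  e = (- 1ℚ) ^ k
  regroup : ∀ e b K w → - 1ℚ * e * b * K * w ≡ - 1ℚ * e * (b * K) * w
  regroup = solve-∀ ℚ-ring
  collect : ∀ e N b w → - 1ℚ * e * (N * b) * w ≡ - N * (e * b * w)
  collect = solve-∀ ℚ-ring

alternatingPowerSum-suc : ∀ m j s → alternatingPowerSum (suc m) (suc j) s ≡
  - nℚ (suc m) * alternatingPowerSum m j (suc s) + nℚ s * alternatingPowerSum (suc m) j s
alternatingPowerSum-suc m j s = begin
  alternatingPowerSum (suc m) (suc j) s                ≡⟨ sumTo-cong (suc m) (λ k _ → split k) ⟩
  sumTo (suc m) (λ k → h k + nℚ s * G k)               ≡⟨ sumTo-distrib-+ (suc m) h (λ k → nℚ s * G k) ⟩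
  sumTo (suc m) h + sumTo (suc m) (λ k → nℚ s * G k)   ≡⟨ cong₂ _+_ (sumTo-unfoldˡ m h) (*-distribˡ-sumTo (suc m) (nℚ s) G) ⟩
  h 0 + sumTo m (λ k → h (suc k)) + nℚ s * G′          ≡⟨ cong₂ (λ u v → u + v + nℚ s * G′) h[0]≡0 (sumTo-cong m (λ k _ → alternatingTerm-absorption m j s k)) ⟩
  0ℚ + sumTo m (λ k → - N * T k) + nℚ s * G′           ≡⟨ cong (λ u → 0ℚ + u + nℚ s * G′) (*-distribˡ-sumTo m (- N) T) ⟩
  0ℚ + - N * alternatingPowerSum m j (suc s) + nℚ s * G′
    ≡⟨ cong (_+ nℚ s * G′) (ℚₚ.+-identityˡ (- N * alternatingPowerSum m j (suc s))) ⟩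
  - N * alternatingPowerSum m j (suc s) + nℚ s * G′    ∎
  where
  open ≡-Reasoning
  N = nℚ (suc m)
  G = λ k → (- 1ℚ) ^ k * binom (suc m) k * nℚ (k ℕ.+ s) ^ j
  G′ = alternatingPowerSum (suc m) j s
  h = λ k → (- 1ℚ) ^ k * binom (suc m) k * nℚ k * nℚ (k ℕ.+ s) ^ j
  T = λ k → (- 1ℚ) ^ k * binom m k * nℚ (k ℕ.+ suc s) ^ j
  split : ∀ k → (- 1ℚ) ^ k * binom (suc m) k * nℚ (k ℕ.+ s) ^ suc j ≡ h k + nℚ s * G k
  split k = trans (cong (λ u → (- 1ℚ) ^ k * binom (suc m) k * (u * nℚ (k ℕ.+ s) ^ j)) (nℚ-homo-+ k s))
                  (distrib ((- 1ℚ) ^ k) (binom (suc m) k) (nℚ k) (nℚ s) (nℚ (k ℕ.+ s) ^ j))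
    where
    distrib : ∀ e b K S w → e * b * ((K + S) * w) ≡ e * b * K * w + S * (e * b * w)
    distrib = solve-∀ ℚ-ring
  h[0]≡0 : h 0 ≡ 0ℚ
  h[0]≡0 = trans (cong (_* nℚ s ^ j) (ℚₚ.*-zeroʳ (1ℚ * 1ℚ))) (ℚₚ.*-zeroˡ (nℚ s ^ j))

alternatingPowerSum-below : ∀ j m s → j < m → alternatingPowerSum m j s ≡ 0ℚ
alternatingPowerSum-below zero    (suc m) s _ = begin
  alternatingPowerSum (suc m) 0 s                         ≡⟨ sumTo-cong (suc m) (λ k _ → swap ((- 1ℚ) ^ k) (binom (suc m) k)) ⟩
  sumTo (suc m) (λ k → binom (suc m) k * (- 1ℚ) ^ k)      ≡⟨ binomial-theorem (- 1ℚ) (suc m) ⟩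
  0ℚ * (1ℚ + - 1ℚ) ^ m                                     ≡⟨ ℚₚ.*-zeroˡ ((1ℚ + - 1ℚ) ^ m) ⟩
  0ℚ                                                       ∎
  where
  open ≡-Reasoning
  swap : ∀ e b → e * b * 1ℚ ≡ b * e
  swap = solve-∀ ℚ-ring
alternatingPowerSum-below (suc j) (suc m) s (s≤s j<m) = begin
  alternatingPowerSum (suc m) (suc j) s                  ≡⟨ alternatingPowerSum-suc m j s ⟩
  - nℚ (suc m) * alternatingPowerSum m j (suc s) + nℚ s * alternatingPowerSum (suc m) j s
    ≡⟨ cong₂ (λ u v → - nℚ (suc m) * u + nℚ s * v)
             (alternatingPowerSum-below j m (suc s) j<m) (alternatingPowerSum-below j (suc m) s (ℕₚ.m≤n⇒m≤1+n j<m)) ⟩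
  - nℚ (suc m) * 0ℚ + nℚ s * 0ℚ                          ≡⟨ annihilate (- nℚ (suc m)) (nℚ s) ⟩
  0ℚ                                                     ∎
  where
  open ≡-Reasoning
  annihilate : ∀ a b → a * 0ℚ + b * 0ℚ ≡ 0ℚ
  annihilate = solve-∀ ℚ-ring

alternatingPowerSum-diag : ∀ m s → alternatingPowerSum m m s ≡ (- 1ℚ) ^ m * nℚ (m !)
alternatingPowerSum-diag zero    s = refl
alternatingPowerSum-diag (suc m) s = begin
  alternatingPowerSum (suc m) (suc m) s                  ≡⟨ alternatingPowerSum-suc m m s ⟩
  - nℚ (suc m) * alternatingPowerSum m m (suc s) + nℚ s * alternatingPowerSum (suc m) m s
    ≡⟨ cong₂ (λ u v → - nℚ (suc m) * u + nℚ s * v)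
             (alternatingPowerSum-diag m (suc s)) (alternatingPowerSum-below m (suc m) s ℕₚ.≤-refl) ⟩
  - nℚ (suc m) * ((- 1ℚ) ^ m * nℚ (m !)) + nℚ s * 0ℚ  ≡⟨ collect (nℚ (suc m)) ((- 1ℚ) ^ m) (nℚ (m !)) (nℚ s) ⟩
  - 1ℚ * (- 1ℚ) ^ m * (nℚ (suc m) * nℚ (m !))         ≡⟨ cong ((- 1ℚ) ^ suc m *_) (nℚ-homo-* (suc m) (m !)) ⟨
  (- 1ℚ) ^ suc m * nℚ (suc m !)                       ∎
  where
  open ≡-Reasoning
  collect : ∀ N L F S → - N * (L * F) + S * 0ℚ ≡ - 1ℚ * L * (N * F)
  collect = solve-∀ ℚ-ring

rising : ℕ → ℕ → ℕ
rising r zero    = 1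
rising r (suc i) = suc (r ℕ.+ i) ℕ.* rising r i

[r+i]!≡r!*rising : ∀ r i → (r ℕ.+ i) ! ≡ r ! ℕ.* rising r i
[r+i]!≡r!*rising r zero    = trans (cong _! (ℕₚ.+-identityʳ r)) (sym (ℕₚ.*-identityʳ (r !)))
[r+i]!≡r!*rising r (suc i) = begin
  (r ℕ.+ suc i) !                        ≡⟨ cong _! (ℕₚ.+-suc r i) ⟩
  suc (r ℕ.+ i) ℕ.* (r ℕ.+ i) !          ≡⟨ cong (suc (r ℕ.+ i) ℕ.*_) ([r+i]!≡r!*rising r i) ⟩
  suc (r ℕ.+ i) ℕ.* (r ! ℕ.* rising r i) ≡⟨ x∙yz≈y∙xz (suc (r ℕ.+ i)) (r !) (rising r i) ⟩
  r ! ℕ.* (suc (r ℕ.+ i) ℕ.* rising r i) ∎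
  where open ≡-Reasoning

even-or-odd : ∀ n → ∃[ t ] (n ≡ t ℕ.+ t ⊎ n ≡ suc (t ℕ.+ t))
even-or-odd zero    = 0 , inj₁ refl
even-or-odd (suc n) with even-or-odd n
... | t , inj₁ n≡t+t   = t , inj₂ (cong suc n≡t+t)
... | t , inj₂ n≡1+t+t = suc t , inj₁ (cong suc (trans n≡1+t+t (sym (ℕₚ.+-suc t t))))

n+n≡n*2 : ∀ n → n ℕ.+ n ≡ n ℕ.* 2
n+n≡n*2 n = trans (cong (n ℕ.+_) (sym (ℕₚ.+-identityʳ n))) (ℕₚ.*-comm 2 n)

[n+n]/2≡n : ∀ n → (n ℕ.+ n) / 2 ≡ n
[n+n]/2≡n n = trans (cong (_/ 2) (n+n≡n*2 n)) (m*n/n≡m n 2)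

odd-prime-predecessor : ∀ m → Prime (suc m) → suc m ≢ 2 → ∃[ n ] m ≡ n ℕ.+ n
odd-prime-predecessor m p-prime p≢2 with even-or-odd m
... | n , inj₁ m≡n+n   = n , m≡n+n
... | n , inj₂ m≡1+n+n
  with prime⇒irreducible p-prime (divides (suc n) (trans (cong suc m≡1+n+n) (cong (suc ∘ suc) (n+n≡n*2 n))))
... | inj₁ ()
... | inj₂ 2≡p = ⊥-elim (p≢2 (sym 2≡p))

-- p-integral rationals

abs-divides-product : ∀ (x y : ℤ) {n : ℕ} → x ℤ.* y ≡ + n → ℤ.∣ x ∣ ∣ n
abs-divides-product x y {n} xy≡n = divides ℤ.∣ y ∣ (begin
  n                          ≡⟨ cong ℤ.∣_∣ xy≡n ⟨
  ℤ.∣ x ℤ.* y ∣              ≡⟨ ℤₚ.abs-* x y ⟩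
  ℤ.∣ x ∣ ℕ.* ℤ.∣ y ∣        ≡⟨ ℕₚ.*-comm ℤ.∣ x ∣ ℤ.∣ y ∣ ⟩
  ℤ.∣ y ∣ ℕ.* ℤ.∣ x ∣        ∎)
  where open ≡-Reasoning

module PIntegral (m : ℕ) (p-prime : Prime (suc m)) where

  p : ℕ
  p = suc m

  P : ℚ
  P = nℚ p

  ¬∣⇒coprime : ∀ {a} → ¬ p ∣ a → Coprime a p
  ¬∣⇒coprime p∤a (d∣a , d∣p) with prime⇒irreducible p-prime d∣p
  ... | inj₁ d≡1 = d≡1
  ... | inj₂ refl = ⊥-elim (p∤a d∣a)

  coprime⇒¬∣ : ∀ {a} → Coprime a p → ¬ p ∣ a
  coprime⇒¬∣ a⊥p p∣a = ¬prime[1] (subst Prime (a⊥p (p∣a , ∣-refl)) p-prime)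

  coprime-* : ∀ {a b} → Coprime a p → Coprime b p → Coprime (a ℕ.* b) p
  coprime-* {a} {b} a⊥p b⊥p =
    ¬∣⇒coprime ([ coprime⇒¬∣ a⊥p , coprime⇒¬∣ b⊥p ] ∘ euclidsLemma a b p-prime)

  coprime-∣ : ∀ {a d} → d ∣ a → Coprime a p → Coprime d p
  coprime-∣ d∣a a⊥p (e∣d , e∣p) = a⊥p (∣-trans e∣d d∣a , e∣p)

  m≢0 : m ≢ 0
  m≢0 m≡0 = ¬prime[1] (subst (λ k → Prime (suc k)) m≡0 p-prime)

  ∤-between : ∀ a → 0 < a → a < p → ¬ p ∣ a
  ∤-between a 0<a a<p p∣a = ℕₚ.<⇒≱ a<p (∣⇒≤ {{ℕ.>-nonZero 0<a}} p∣a)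

  Integral : ℚ → Set
  Integral r = Coprime (ℚ.↧ₙ r) p

  integral-+ : ∀ x y → Integral x → Integral y → Integral (x + y)
  integral-+ x y ix iy = coprime-∣ (abs-divides-product (ℚ.↧ (x + y)) _ (ℚₚ.↧-+ x y)) (coprime-* ix iy)

  integral-* : ∀ x y → Integral x → Integral y → Integral (x * y)
  integral-* x y ix iy = coprime-∣ (abs-divides-product (ℚ.↧ (x * y)) _ (ℚₚ.↧-* x y)) (coprime-* ix iy)

  integral-neg : ∀ x → Integral x → Integral (- x)
  integral-neg x ix = subst (λ d → Coprime d p) (sym (cong ℤ.∣_∣ (ℚₚ.↧-neg x))) ix

  integral-- : ∀ x y → Integral x → Integral y → Integral (x - y)
  integral-- x y ix iy = integral-+ x (- y) ix (integral-neg y iy)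

  integral-/ : ∀ i d → Coprime (suc d) p → Integral (i ℚ./ suc d)
  integral-/ i d d⊥p = coprime-∣ (abs-divides-product (ℚ.↧ (i ℚ./ suc d)) _ (ℚₚ.↧-/ i (suc d))) d⊥p

  integral-nℚ : ∀ a → Integral (nℚ a)
  integral-nℚ a = integral-/ (+ a) 0 (Coprimality.1-coprimeTo p)

  integral-recip : ∀ d → Coprime d p → Integral (recip d)
  integral-recip zero    _   = integral-nℚ 0
  integral-recip (suc d) d⊥p = integral-/ (+ 1) d d⊥p

  integral-recip< : ∀ d → d < p → Integral (recip d)
  integral-recip< zero    _   = integral-nℚ 0
  integral-recip< (suc d) d<p = integral-recip (suc d) (Coprimality.sym (Coprimality.prime⇒coprime p-prime d<p))

  integral-^ : ∀ x k → Integral x → Integral (x ^ k)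
  integral-^ x zero    ix = integral-nℚ 1
  integral-^ x (suc k) ix = integral-* x (x ^ k) ix (integral-^ x k ix)

  integral-binom : ∀ n k → Integral (binom n k)
  integral-binom n k = subst Integral (nℚ-C≡binom n k) (integral-nℚ (n C k))

  integral-sumFrom1 : ∀ n (f : ℕ → ℚ) → (∀ k → k ≤ n → Integral (f k)) → Integral (sumFrom1 n f)
  integral-sumFrom1 zero    f _  = integral-nℚ 0
  integral-sumFrom1 (suc n) f if = integral-+ (sumFrom1 n f) (f (suc n))
    (integral-sumFrom1 n f (λ k k≤n → if k (ℕₚ.m≤n⇒m≤1+n k≤n))) (if (suc n) ℕₚ.≤-refl)

  integral-[-1]^ : ∀ k → Integral ((- 1ℚ) ^ k)
  integral-[-1]^ k = integral-^ (- 1ℚ) k (integral-neg 1ℚ (integral-nℚ 1))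

  integral-[-2] : Integral (- nℚ 2)
  integral-[-2] = integral-neg (nℚ 2) (integral-nℚ 2)

  integral-harmonic : ∀ k → k < p → Integral (harmonic k)
  integral-harmonic k k<p = integral-sumFrom1 k recip (λ j j≤k → integral-recip< j (ℕₚ.≤-<-trans j≤k k<p))

  integral-termB : ∀ k → k < p → Integral (termB k)
  integral-termB zero    _   = integral-nℚ 0
  integral-termB (suc j) j<p = subst Integral (sym (/≡*recip (2 ℕ.^ suc j) (suc j)))
    (integral-* (nℚ (2 ℕ.^ suc j)) (recip (suc j)) (integral-nℚ (2 ℕ.^ suc j)) (integral-recip< (suc j) j<p))

  integral-near-one : ∀ u → Integral u → Integral (1ℚ - P * u)
  integral-near-one u iu = integral-- 1ℚ (P * u) (integral-nℚ 1) (integral-* P u (integral-nℚ p) iu)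

  infix 4 _≡_[mod_]

  -- (a - b)/c is p-integral; for c = P ^ k this is CongModPow p k a b.  A record rather than a
  -- Σ-type, so that a, b and c can be inferred.
  record _≡_[mod_] (a b c : ℚ) : Set where
    constructor witness
    field
      quotient   : ℚ
      integral   : Integral quotient
      difference : a - b ≡ c * quotient

  mod-reflexive : ∀ {a b c} → a ≡ b → a ≡ b [mod c ]
  mod-reflexive {a} {_} {c} refl = witness 0ℚ (integral-nℚ 0) (vanish a c)
    where
    vanish : ∀ a c → a - a ≡ c * 0ℚ
    vanish = solve-∀ ℚ-ring

  mod-refl : ∀ {a c} → a ≡ a [mod c ]
  mod-refl = mod-reflexive refl

  mod-sym : ∀ {a b c} → a ≡ b [mod c ] → b ≡ a [mod c ]
  mod-sym {a} {b} {c} (witness r ir a-b≡cr) = witness (- r) (integral-neg r ir) (begin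
    b - a        ≡⟨ flip a b ⟩
    - (a - b)    ≡⟨ cong -_ a-b≡cr ⟩
    - (c * r)    ≡⟨ ℚₚ.neg-distribʳ-* c r ⟩
    c * - r      ∎)
    where
    open ≡-Reasoning
    flip : ∀ a b → b - a ≡ - (a - b)
    flip = solve-∀ ℚ-ring

  mod-trans : ∀ {a b d c} → a ≡ b [mod c ] → b ≡ d [mod c ] → a ≡ d [mod c ]
  mod-trans {a} {b} {d} {c} (witness r ir a-b≡cr) (witness s is b-d≡cs) =
    witness (r + s) (integral-+ r s ir is) (begin
      a - d                  ≡⟨ telescope a b d ⟩
      (a - b) + (b - d)      ≡⟨ cong₂ _+_ a-b≡cr b-d≡cs ⟩
      c * r + c * s          ≡⟨ ℚₚ.*-distribˡ-+ c r s ⟨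
      c * (r + s)            ∎)
    where
    open ≡-Reasoning
    telescope : ∀ a b d → a - d ≡ (a - b) + (b - d)
    telescope = solve-∀ ℚ-ring

  ≡[mod]-setoid : ℚ → Setoid 0ℓ 0ℓ
  ≡[mod]-setoid c = record
    { Carrier       = ℚ
    ; _≈_           = _≡_[mod c ]
    ; isEquivalence = record { refl = mod-refl ; sym = mod-sym ; trans = mod-trans }
    }

  module ≡[mod]-Reasoning (c : ℚ) = SetoidReasoning (≡[mod]-setoid c)

  mod-+ : ∀ {a b a′ b′ c} → a ≡ b [mod c ] → a′ ≡ b′ [mod c ] → a + a′ ≡ b + b′ [mod c ]
  mod-+ {a} {b} {a′} {b′} {c} (witness r ir a-b≡cr) (witness s is a′-b′≡cs) =
    witness (r + s) (integral-+ r s ir is) (begin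
      (a + a′) - (b + b′)    ≡⟨ regroup a a′ b b′ ⟩
      (a - b) + (a′ - b′)    ≡⟨ cong₂ _+_ a-b≡cr a′-b′≡cs ⟩
      c * r + c * s          ≡⟨ ℚₚ.*-distribˡ-+ c r s ⟨
      c * (r + s)            ∎)
    where
    open ≡-Reasoning
    regroup : ∀ a a′ b b′ → (a + a′) - (b + b′) ≡ (a - b) + (a′ - b′)
    regroup = solve-∀ ℚ-ring

  mod-neg : ∀ {a b c} → a ≡ b [mod c ] → - a ≡ - b [mod c ]
  mod-neg {a} {b} {c} (witness r ir a-b≡cr) = witness (- r) (integral-neg r ir) (begin
    - a - - b    ≡⟨ regroup a b ⟩
    - (a - b)    ≡⟨ cong -_ a-b≡cr ⟩
    - (c * r)    ≡⟨ ℚₚ.neg-distribʳ-* c r ⟩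
    c * - r      ∎)
    where
    open ≡-Reasoning
    regroup : ∀ a b → - a - - b ≡ - (a - b)
    regroup = solve-∀ ℚ-ring

  mod-*ˡ : ∀ {a b c} z → Integral z → a ≡ b [mod c ] → z * a ≡ z * b [mod c ]
  mod-*ˡ {a} {b} {c} z iz (witness r ir a-b≡cr) = witness (z * r) (integral-* z r iz ir) (begin
    z * a - z * b    ≡⟨ factor z a b ⟩
    z * (a - b)      ≡⟨ cong (z *_) a-b≡cr ⟩
    z * (c * r)      ≡⟨ swap z c r ⟩
    c * (z * r)      ∎)
    where
    open ≡-Reasoning
    factor : ∀ z a b → z * a - z * b ≡ z * (a - b)
    factor = solve-∀ ℚ-ring
    swap : ∀ z c r → z * (c * r) ≡ c * (z * r)
    swap = solve-∀ ℚ-ring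

  mod-* : ∀ {a b a′ b′ c} → Integral a′ → Integral b →
          a ≡ b [mod c ] → a′ ≡ b′ [mod c ] → a * a′ ≡ b * b′ [mod c ]
  mod-* {a} {b} {a′} {b′} {c} ia′ ib (witness r ir a-b≡cr) (witness s is a′-b′≡cs) =
    witness (r * a′ + b * s) (integral-+ (r * a′) (b * s) (integral-* r a′ ir ia′) (integral-* b s ib is)) (begin
      a * a′ - b * b′                ≡⟨ split a b a′ b′ ⟩
      (a - b) * a′ + b * (a′ - b′)   ≡⟨ cong₂ (λ u v → u * a′ + b * v) a-b≡cr a′-b′≡cs ⟩
      c * r * a′ + b * (c * s)       ≡⟨ collect c r a′ b s ⟩
      c * (r * a′ + b * s)           ∎)
    where
    open ≡-Reasoning
    split : ∀ a b a′ b′ → a * a′ - b * b′ ≡ (a - b) * a′ + b * (a′ - b′)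
    split = solve-∀ ℚ-ring
    collect : ∀ c r a′ b s → c * r * a′ + b * (c * s) ≡ c * (r * a′ + b * s)
    collect = solve-∀ ℚ-ring

  mod-^ : ∀ {a b c} k → Integral a → Integral b → a ≡ b [mod c ] → a ^ k ≡ b ^ k [mod c ]
  mod-^         zero    ia ib a≡b = mod-refl
  mod-^ {a} {b} (suc k) ia ib a≡b = mod-* (integral-^ a k ia) ib a≡b (mod-^ k ia ib a≡b)

  mod-sumTo : ∀ {c} n {f g : ℕ → ℚ} → (∀ k → k ≤ n → f k ≡ g k [mod c ]) → sumTo n f ≡ sumTo n g [mod c ]
  mod-sumTo zero    f≡g = f≡g 0 z≤n
  mod-sumTo (suc n) f≡g = mod-+ (mod-sumTo n (λ k k≤n → f≡g k (ℕₚ.m≤n⇒m≤1+n k≤n))) (f≡g (suc n) ℕₚ.≤-refl)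

  multiple≡0 : ∀ c z → Integral z → c * z ≡ 0ℚ [mod c ]
  multiple≡0 c z iz = witness z iz (ℚₚ.+-identityʳ (c * z))

  mod-weaken : ∀ {a b c} d → Integral d → a ≡ b [mod c * d ] → a ≡ b [mod c ]
  mod-weaken {c = c} d id (witness r ir a-b≡cdr) =
    witness (d * r) (integral-* d r id ir) (trans a-b≡cdr (ℚₚ.*-assoc c d r))

  ∣⇒≡0 : ∀ x → p ∣ x → nℚ x ≡ 0ℚ [mod P ]
  ∣⇒≡0 x (divides q refl) = witness (nℚ q) (integral-nℚ q) (begin
    nℚ (q ℕ.* p) - 0ℚ   ≡⟨ ℚₚ.+-identityʳ (nℚ (q ℕ.* p)) ⟩
    nℚ (q ℕ.* p)        ≡⟨ nℚ-homo-* q p ⟩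
    nℚ q * P            ≡⟨ ℚₚ.*-comm (nℚ q) P ⟩
    P * nℚ q            ∎)
    where open ≡-Reasoning

  ≡0⇒∣ : ∀ x → nℚ x ≡ 0ℚ [mod P ] → p ∣ x
  ≡0⇒∣ x (witness r@(mkℚ num d _) d⊥p x-0≡Pr) =
    Coprimality.coprime-divisor (Coprimality.sym d⊥p) (divides ℤ.∣ num ∣ cross)
    where
    x≃Pr : ℚᵘ.mkℚᵘ (+ x) 0 ℚᵘ.≃ ℚᵘ.mkℚᵘ (+ p) 0 ℚᵘ.* ℚᵘ.mkℚᵘ num d
    x≃Pr = begin
      ℚᵘ.mkℚᵘ (+ x) 0                   ≈⟨ toℚᵘ-/ (+ x) 0 ⟨
      toℚᵘ (nℚ x)                       ≡⟨ cong toℚᵘ (trans (sym (ℚₚ.+-identityʳ (nℚ x))) x-0≡Pr) ⟩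
      toℚᵘ (P * r)                      ≈⟨ ℚₚ.toℚᵘ-homo-* P r ⟩
      toℚᵘ P ℚᵘ.* toℚᵘ r                ≈⟨ ℚᵘₚ.*-congʳ (toℚᵘ-/ (+ p) 0) ⟩
      ℚᵘ.mkℚᵘ (+ p) 0 ℚᵘ.* ℚᵘ.mkℚᵘ num d ∎
      where open ℚᵘₚ.≃-Reasoning
    cross-ℤ : + x ℤ.* + (1 ℕ.* suc d) ≡ (+ p ℤ.* num) ℤ.* + 1
    cross-ℤ with x≃Pr
    ... | ℚᵘ.*≡* eq = eq
    cross : suc d ℕ.* x ≡ ℤ.∣ num ∣ ℕ.* p
    cross = begin
      suc d ℕ.* x                        ≡⟨ ℕₚ.*-comm (suc d) x ⟩
      x ℕ.* suc d                        ≡⟨ cong (x ℕ.*_) (ℕₚ.*-identityˡ (suc d)) ⟨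
      x ℕ.* (1 ℕ.* suc d)                ≡⟨ ℤₚ.abs-* (+ x) (+ (1 ℕ.* suc d)) ⟨
      ℤ.∣ + x ℤ.* + (1 ℕ.* suc d) ∣      ≡⟨ cong ℤ.∣_∣ cross-ℤ ⟩
      ℤ.∣ (+ p ℤ.* num) ℤ.* + 1 ∣        ≡⟨ cong ℤ.∣_∣ (ℤₚ.*-identityʳ (+ p ℤ.* num)) ⟩
      ℤ.∣ + p ℤ.* num ∣                  ≡⟨ ℤₚ.abs-* (+ p) num ⟩
      p ℕ.* ℤ.∣ num ∣                    ≡⟨ ℕₚ.*-comm p ℤ.∣ num ∣ ⟩
      ℤ.∣ num ∣ ℕ.* p                    ∎
      where open ≡-Reasoning

  mod-cancelˡ : ∀ a {y z} → ¬ p ∣ a → nℚ a * y ≡ nℚ a * z [mod P ] → y ≡ z [mod P ]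
  mod-cancelˡ zero    p∤a _ = ⊥-elim (p∤a (p ∣0))
  mod-cancelˡ (suc a) {y} {z} p∤a ay≡az = begin
    y                              ≡⟨ recip-cancelˡ (suc a) y ⟨
    recip (suc a) * (nℚ (suc a) * y) ≈⟨ mod-*ˡ (recip (suc a)) (integral-recip (suc a) (¬∣⇒coprime p∤a)) ay≡az ⟩
    recip (suc a) * (nℚ (suc a) * z) ≡⟨ recip-cancelˡ (suc a) z ⟩
    z                              ∎
    where open ≡[mod]-Reasoning P

  ≡%p : ∀ a → nℚ a ≡ nℚ (a % p) [mod P ]
  ≡%p a = begin
    nℚ a                              ≡⟨ cong nℚ (m≡m%n+[m/n]*n a p) ⟩
    nℚ (a % p ℕ.+ a / p ℕ.* p)        ≡⟨ nℚ-homo-+ (a % p) (a / p ℕ.* p) ⟩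
    nℚ (a % p) + nℚ (a / p ℕ.* p)     ≈⟨ mod-+ (mod-refl {nℚ (a % p)}) (∣⇒≡0 (a / p ℕ.* p) (divides (a / p) refl)) ⟩
    nℚ (a % p) + 0ℚ                   ≡⟨ ℚₚ.+-identityʳ (nℚ (a % p)) ⟩
    nℚ (a % p)                        ∎
    where open ≡[mod]-Reasoning P

  small≢0-mod : ∀ a → 0 < a → a < p → ¬ (nℚ a ≡ 0ℚ [mod P ])
  small≢0-mod a 0<a a<p = ∤-between a 0<a a<p ∘ ≡0⇒∣ a

  near-one-* : ∀ u v → Integral u → Integral v → (1ℚ - P * u) * (1ℚ - P * v) ≡ 1ℚ - P * (u + v) [mod P * P ]
  near-one-* u v iu iv = witness (u * v) (integral-* u v iu iv) (expand P u v)
    where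
    expand : ∀ P u v → (1ℚ - P * u) * (1ℚ - P * v) - (1ℚ - P * (u + v)) ≡ P * P * (u * v)
    expand = solve-∀ ℚ-ring

  mod-modulus : ∀ {a b c c′} → c ≡ c′ → a ≡ b [mod c ] → a ≡ b [mod c′ ]
  mod-modulus refl a≡b = a≡b

  ≡[mod]⇒CongModPow : ∀ k {a b} → a ≡ b [mod P ^ k ] → CongModPow p k a b
  ≡[mod]⇒CongModPow k (witness r ir a-b≡Pᵏr) = r , trans a-b≡Pᵏr (cong (_* r) (sym (nℚ-homo-^ p k))) , ir

  -- Fermat and Wilson

  binom-prime≡0 : ∀ j → j < m → binom p (suc j) ≡ 0ℚ [mod P ]
  binom-prime≡0 j j<m = begin
    binom p (suc j)                       ≡⟨ *nℚ≡⇒≡*recip (binom p (suc j)) _ (suc j) (binom-absorption m j) ⟩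
    P * binom m j * recip (suc j)         ≡⟨ ℚₚ.*-assoc P (binom m j) (recip (suc j)) ⟩
    P * (binom m j * recip (suc j))       ≈⟨ multiple≡0 P _ (integral-* (binom m j) (recip (suc j))
                                               (integral-binom m j) (integral-recip< (suc j) (s≤s j<m))) ⟩
    0ℚ                                    ∎
    where open ≡[mod]-Reasoning P

  binomial-prefix≡1 : ∀ x n → Integral x → n ≤ m → sumTo n (λ k → binom p k * x ^ k) ≡ 1ℚ [mod P ]
  binomial-prefix≡1 x zero    _  _     = mod-refl
  binomial-prefix≡1 x (suc n) ix 1+n≤m = begin
    sumTo n (λ k → binom p k * x ^ k) + binom p (suc n) * x ^ suc n
      ≈⟨ mod-+ (binomial-prefix≡1 x n ix (ℕₚ.<⇒≤ 1+n≤m))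
               (mod-* (integral-^ x (suc n) ix) (integral-nℚ 0) (binom-prime≡0 n 1+n≤m) mod-refl) ⟩
    1ℚ + 0ℚ * x ^ suc n   ≡⟨ cong (_+_ 1ℚ) (ℚₚ.*-zeroˡ (x ^ suc n)) ⟩
    1ℚ                    ∎
    where open ≡[mod]-Reasoning P

  freshmans-dream : ∀ x → Integral x → (1ℚ + x) ^ p ≡ 1ℚ + x ^ p [mod P ]
  freshmans-dream x ix = begin
    (1ℚ + x) ^ p                                                     ≡⟨ binomial-theorem x p ⟨
    sumTo m (λ k → binom p k * x ^ k) + binom p p * x ^ p            ≈⟨ mod-+ (binomial-prefix≡1 x m ix ℕₚ.≤-refl) mod-refl ⟩
    1ℚ + binom p p * x ^ p                                           ≡⟨ cong (λ b → 1ℚ + b * x ^ p) (binom-diag p) ⟩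
    1ℚ + 1ℚ * x ^ p                                                  ≡⟨ cong (_+_ 1ℚ) (ℚₚ.*-identityˡ (x ^ p)) ⟩
    1ℚ + x ^ p                                                       ∎
    where open ≡[mod]-Reasoning P

  fermat : ∀ a → nℚ a ^ p ≡ nℚ a [mod P ]
  fermat zero    = mod-reflexive (ℚₚ.*-zeroˡ (0ℚ ^ m))
  fermat (suc a) = begin
    nℚ (suc a) ^ p       ≡⟨ cong (λ y → y ^ p) (nℚ-homo-+ 1 a) ⟩
    (1ℚ + nℚ a) ^ p      ≈⟨ freshmans-dream (nℚ a) (integral-nℚ a) ⟩
    1ℚ + nℚ a ^ p        ≈⟨ mod-+ (mod-refl {1ℚ}) (fermat a) ⟩
    1ℚ + nℚ a            ≡⟨ nℚ-homo-+ 1 a ⟨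
    nℚ (suc a)           ∎
    where open ≡[mod]-Reasoning P

  fermat-little : ∀ a → ¬ p ∣ a → nℚ a ^ m ≡ 1ℚ [mod P ]
  fermat-little a p∤a = mod-cancelˡ a p∤a (begin
    nℚ a * nℚ a ^ m      ≈⟨ fermat a ⟩
    nℚ a                 ≡⟨ ℚₚ.*-identityʳ (nℚ a) ⟨
    nℚ a * 1ℚ            ∎)
    where open ≡[mod]-Reasoning P

  p-1≡-1 : nℚ m ≡ - 1ℚ [mod P ]
  p-1≡-1 = witness 1ℚ (integral-nℚ 1) (begin
    nℚ m - - 1ℚ    ≡⟨ ℚₚ.+-comm (nℚ m) 1ℚ ⟩
    1ℚ + nℚ m      ≡⟨ nℚ-homo-+ 1 m ⟨
    P              ≡⟨ ℚₚ.*-identityʳ P ⟨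
    P * 1ℚ         ∎)
    where open ≡-Reasoning

  alternating-binom≡1 : ∀ k → k ≤ m → (- 1ℚ) ^ k * binom m k ≡ 1ℚ [mod P ]
  alternating-binom≡1 zero    _   = mod-refl
  alternating-binom≡1 (suc k) k<m = begin
    - 1ℚ * L * b₁                      ≡⟨ pascal L b₀ b₁ ⟩
    L * b₀ + - 1ℚ * L * (b₀ + b₁)      ≈⟨ mod-+ (alternating-binom≡1 k (ℕₚ.<⇒≤ k<m))
                                                 (mod-*ˡ (- 1ℚ * L) (integral-[-1]^ (suc k)) (binom-prime≡0 k k<m)) ⟩
    1ℚ + - 1ℚ * L * 0ℚ                 ≡⟨ cong (_+_ 1ℚ) (ℚₚ.*-zeroʳ (- 1ℚ * L)) ⟩
    1ℚ                                 ∎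
    where
    open ≡[mod]-Reasoning P
    L = (- 1ℚ) ^ k
    b₀ = binom m k
    b₁ = binom m (suc k)
    pascal : ∀ L b₀ b₁ → - 1ℚ * L * b₁ ≡ L * b₀ + - 1ℚ * L * (b₀ + b₁)
    pascal = solve-∀ ℚ-ring

  wilson : (- 1ℚ) ^ m * nℚ (m !) ≡ - 1ℚ [mod P ]
  wilson = begin
    (- 1ℚ) ^ m * nℚ (m !)        ≡⟨ alternatingPowerSum-diag m 0 ⟨
    alternatingPowerSum m m 0    ≈⟨ mod-sumTo m term≡indicator ⟩
    sumTo m positiveIndicator    ≡⟨ sumTo-positiveIndicator m ⟩
    nℚ m                         ≈⟨ p-1≡-1 ⟩
    - 1ℚ                         ∎
    where
    open ≡[mod]-Reasoning P
    term≡indicator : ∀ k → k ≤ m → (- 1ℚ) ^ k * binom m k * nℚ (k ℕ.+ 0) ^ m ≡ positiveIndicator k [mod P ]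
    term≡indicator zero    _   = mod-reflexive (trans (ℚₚ.*-identityˡ (0ℚ ^ m)) (0^n≡0 m m≢0))
    term≡indicator (suc k) k<m rewrite ℕₚ.+-identityʳ k =
      mod-* (integral-^ (nℚ (suc k)) m (integral-nℚ (suc k))) (integral-nℚ 1)
            (alternating-binom≡1 (suc k) k<m) (fermat-little (suc k) (∤-between (suc k) (s≤s z≤n) (s≤s k<m)))

  module OddPrime (n : ℕ) (m≡n+n : m ≡ n ℕ.+ n) where

    n≢0 : n ≢ 0
    n≢0 n≡0 = m≢0 (trans m≡n+n (cong (λ j → j ℕ.+ j) n≡0))

    2<p : 2 < p
    2<p = s≤s (subst (2 ≤_) (sym m≡n+n) (2≤j+j n n≢0))
      where
      2≤j+j : ∀ j → j ≢ 0 → 2 ≤ j ℕ.+ j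
      2≤j+j zero    j≢0 = ⊥-elim (j≢0 refl)
      2≤j+j (suc j) _   = s≤s (subst (1 ≤_) (sym (ℕₚ.+-suc j j)) (s≤s z≤n))

    n<p : n < p
    n<p = s≤s (subst (n ≤_) (sym m≡n+n) (ℕₚ.m≤m+n n n))

    -- The Legendre symbol (-1/p)

    nℚ-complement : ∀ i → i ≤ n → nℚ (suc (n ℕ.+ i)) ≡ P - nℚ (n ℕ.∸ i)
    nℚ-complement i i≤n = begin
      nℚ (suc (n ℕ.+ i))                          ≡⟨ add-sub (nℚ (suc (n ℕ.+ i))) (nℚ (n ℕ.∸ i)) ⟩
      nℚ (suc (n ℕ.+ i)) + nℚ (n ℕ.∸ i) - nℚ (n ℕ.∸ i) ≡⟨ cong (_- nℚ (n ℕ.∸ i)) (nℚ-homo-+ (suc (n ℕ.+ i)) (n ℕ.∸ i)) ⟨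
      nℚ (suc (n ℕ.+ i) ℕ.+ (n ℕ.∸ i)) - nℚ (n ℕ.∸ i) ≡⟨ cong (λ k → nℚ (suc k) - nℚ (n ℕ.∸ i)) sum≡ ⟩
      P - nℚ (n ℕ.∸ i)                            ∎
      where
      open ≡-Reasoning
      add-sub : ∀ a M → a ≡ a + M - M
      add-sub = solve-∀ ℚ-ring
      sum≡ : n ℕ.+ i ℕ.+ (n ℕ.∸ i) ≡ m
      sum≡ = trans (ℕₚ.+-assoc n i (n ℕ.∸ i)) (trans (cong (n ℕ.+_) (ℕₚ.m+[n∸m]≡n i≤n)) (sym m≡n+n))

    rising-reflection : ∀ i → i ≤ n → nℚ (rising n i) * nℚ ((n ℕ.∸ i) !) ≡ (- 1ℚ) ^ i * nℚ (n !) [mod P ]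
    rising-reflection zero    _     = mod-refl
    rising-reflection (suc i) 1+i≤n = begin
      nℚ (suc (n ℕ.+ i) ℕ.* rising n i) * Z    ≡⟨ cong (_* Z) (nℚ-homo-* (suc (n ℕ.+ i)) (rising n i)) ⟩
      nℚ (suc (n ℕ.+ i)) * R * Z              ≡⟨ cong (λ u → u * R * Z) (nℚ-complement i (ℕₚ.<⇒≤ 1+i≤n)) ⟩
      (P - M) * R * Z                         ≡⟨ split P M R Z ⟩
      P * (R * Z) + - (R * (M * Z))
        ≈⟨ mod-+ (multiple≡0 P (R * Z) (integral-* R Z (integral-nℚ (rising n i)) (integral-nℚ ((n ℕ.∸ suc i) !)))) mod-refl ⟩
      0ℚ + - (R * (M * Z))                    ≡⟨ ℚₚ.+-identityˡ (- (R * (M * Z))) ⟩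
      - (R * (M * Z))                         ≡⟨ cong (λ u → - (R * u)) M*Z≡[n∸i]! ⟩
      - (R * nℚ ((n ℕ.∸ i) !))                ≈⟨ mod-neg (rising-reflection i (ℕₚ.<⇒≤ 1+i≤n)) ⟩
      - ((- 1ℚ) ^ i * nℚ (n !))               ≡⟨ negate ((- 1ℚ) ^ i) (nℚ (n !)) ⟩
      (- 1ℚ) ^ suc i * nℚ (n !)               ∎
      where
      open ≡[mod]-Reasoning P
      R = nℚ (rising n i)
      M = nℚ (n ℕ.∸ i)
      Z = nℚ ((n ℕ.∸ suc i) !)
      n∸i≡ : n ℕ.∸ i ≡ suc (n ℕ.∸ suc i)
      n∸i≡ = ℕₚ.+-∸-assoc 1 1+i≤n
      M*Z≡[n∸i]! : M * Z ≡ nℚ ((n ℕ.∸ i) !)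
      M*Z≡[n∸i]! = trans (cong (λ k → nℚ k * Z) n∸i≡)
                     (trans (sym (nℚ-homo-* (suc (n ℕ.∸ suc i)) ((n ℕ.∸ suc i) !))) (cong (λ k → nℚ (k !)) (sym n∸i≡)))
      split : ∀ P M R Z → (P - M) * R * Z ≡ P * (R * Z) + - (R * (M * Z))
      split = solve-∀ ℚ-ring
      negate : ∀ L N → - (L * N) ≡ - 1ℚ * L * N
      negate = solve-∀ ℚ-ring

    half-factorial-square : (- 1ℚ) ^ n * (nℚ (n !) * nℚ (n !)) ≡ - 1ℚ [mod P ]
    half-factorial-square = begin
      (- 1ℚ) ^ n * (N * N)                    ≡⟨ regroup ((- 1ℚ) ^ n) N ⟩
      N * ((- 1ℚ) ^ n * N)                    ≈⟨ mod-*ˡ N (integral-nℚ (n !)) (rising-reflection n ℕₚ.≤-refl) ⟨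
      N * (nℚ (rising n n) * nℚ ((n ℕ.∸ n) !)) ≡⟨ cong (λ k → N * (nℚ (rising n n) * nℚ (k !))) (ℕₚ.n∸n≡0 n) ⟩
      N * (nℚ (rising n n) * 1ℚ)              ≡⟨ cong (N *_) (ℚₚ.*-identityʳ (nℚ (rising n n))) ⟩
      N * nℚ (rising n n)                     ≡⟨ nℚ-homo-* (n !) (rising n n) ⟨
      nℚ (n ! ℕ.* rising n n)                 ≡⟨ cong nℚ (trans (cong _! m≡n+n) ([r+i]!≡r!*rising n n)) ⟨
      nℚ (m !)                                ≡⟨ ℚₚ.*-identityˡ (nℚ (m !)) ⟨
      1ℚ * nℚ (m !)                           ≡⟨ cong (_* nℚ (m !)) [-1]^m≡1 ⟨
      (- 1ℚ) ^ m * nℚ (m !)                   ≈⟨ wilson ⟩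
      - 1ℚ                                    ∎
      where
      open ≡[mod]-Reasoning P
      N = nℚ (n !)
      regroup : ∀ L N → L * (N * N) ≡ N * (L * N)
      regroup = solve-∀ ℚ-ring
      [-1]^m≡1 : (- 1ℚ) ^ m ≡ 1ℚ
      [-1]^m≡1 = trans (cong ((- 1ℚ) ^_) m≡n+n) ([-1]^[n+n]≡1 n)

    square-root-of-minus-one : ∀ t → n ≡ t ℕ.+ t → p ∣ (n ! % p) ℕ.* (n ! % p) ℕ.+ 1
    square-root-of-minus-one t n≡t+t = ≡0⇒∣ (x ℕ.* x ℕ.+ 1) (begin
      nℚ (x ℕ.* x ℕ.+ 1)                   ≡⟨ nℚ-square+1 x ⟩
      X * X + 1ℚ
        ≈⟨ mod-+ (mod-* (integral-nℚ x) (integral-nℚ (n !)) (mod-sym (≡%p (n !))) (mod-sym (≡%p (n !)))) (mod-refl {1ℚ}) ⟩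
      N * N + 1ℚ                           ≡⟨ cong (_+ 1ℚ) (ℚₚ.*-identityˡ (N * N)) ⟨
      1ℚ * (N * N) + 1ℚ                    ≡⟨ cong (λ u → u * (N * N) + 1ℚ) [-1]^n≡1 ⟨
      (- 1ℚ) ^ n * (N * N) + 1ℚ            ≈⟨ mod-+ half-factorial-square (mod-refl {1ℚ}) ⟩
      - 1ℚ + 1ℚ                            ≡⟨⟩
      0ℚ                                   ∎)
      where
      open ≡[mod]-Reasoning P
      x = n ! % p
      X = nℚ x
      N = nℚ (n !)
      [-1]^n≡1 : (- 1ℚ) ^ n ≡ 1ℚ
      [-1]^n≡1 = trans (cong ((- 1ℚ) ^_) n≡t+t) ([-1]^[n+n]≡1 t)

    no-square-root-of-minus-one : ∀ t → n ≡ suc (t ℕ.+ t) → ∀ x → ¬ p ∣ x ℕ.* x ℕ.+ 1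
    no-square-root-of-minus-one t n≡1+t+t x p∣x²+1 = small≢0-mod 2 (s≤s z≤n) 2<p (begin
      nℚ 2                    ≡⟨⟩
      1ℚ + 1ℚ                 ≈⟨ mod-+ (mod-sym (fermat-little x p∤x)) (mod-refl {1ℚ}) ⟩
      X ^ m + 1ℚ              ≡⟨ cong (λ k → X ^ k + 1ℚ) m≡n+n ⟩
      X ^ (n ℕ.+ n) + 1ℚ      ≡⟨ cong (_+ 1ℚ) (^-double X n) ⟩
      (X * X) ^ n + 1ℚ
        ≈⟨ mod-+ (mod-^ n (integral-* X X (integral-nℚ x) (integral-nℚ x)) (integral-neg 1ℚ (integral-nℚ 1)) X²≡-1) (mod-refl {1ℚ}) ⟩
      (- 1ℚ) ^ n + 1ℚ         ≡⟨ cong (λ u → u + 1ℚ) [-1]^n≡-1 ⟩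
      - 1ℚ + 1ℚ               ≡⟨⟩
      0ℚ                      ∎)
      where
      open ≡[mod]-Reasoning P
      X = nℚ x
      [-1]^n≡-1 : (- 1ℚ) ^ n ≡ - 1ℚ
      [-1]^n≡-1 = trans (cong ((- 1ℚ) ^_) n≡1+t+t) ([-1]^[1+n+n]≡-1 t)
      X²≡-1 : X * X ≡ - 1ℚ [mod P ]
      X²≡-1 = begin
        X * X                         ≡⟨ add-sub (X * X) ⟩
        X * X + 1ℚ - 1ℚ               ≡⟨ cong (_- 1ℚ) (nℚ-square+1 x) ⟨
        nℚ (x ℕ.* x ℕ.+ 1) - 1ℚ       ≈⟨ mod-+ (∣⇒≡0 (x ℕ.* x ℕ.+ 1) p∣x²+1) (mod-refl { - 1ℚ}) ⟩
        0ℚ - 1ℚ                       ≡⟨⟩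
        - 1ℚ                          ∎
        where
        add-sub : ∀ y → y ≡ y + 1ℚ - 1ℚ
        add-sub = solve-∀ ℚ-ring
      p∤x : ¬ p ∣ x
      p∤x p∣x = small≢0-mod 1 (s≤s z≤n) (ℕₚ.<-trans (s≤s (s≤s z≤n)) 2<p) (begin
        1ℚ                 ≡⟨⟩
        - (- 1ℚ)           ≈⟨ mod-neg X²≡-1 ⟨
        - (X * X)          ≈⟨ mod-neg (mod-* (integral-nℚ x) (integral-nℚ 0) (∣⇒≡0 x p∣x) (∣⇒≡0 x p∣x)) ⟩
        - (0ℚ * 0ℚ)        ≡⟨⟩
        0ℚ                 ∎)

    root? : Dec (Any (λ x → p ∣ x ℕ.* x ℕ.+ 1) (upTo p))
    root? = any? (λ x → p ∣? (x ℕ.* x ℕ.+ 1)) (upTo p)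

    legendre : legendreMinus1 p ≡ (- 1ℚ) ^ n
    legendre with even-or-odd n
    ... | t , inj₁ n≡t+t = begin
      legendreMinus1 p    ≡⟨ cong (λ b → if b then 1ℚ else - 1ℚ) (dec-true root? root) ⟩
      1ℚ                  ≡⟨ [-1]^[n+n]≡1 t ⟨
      (- 1ℚ) ^ (t ℕ.+ t)  ≡⟨ cong ((- 1ℚ) ^_) n≡t+t ⟨
      (- 1ℚ) ^ n          ∎
      where
      open ≡-Reasoning
      root : Any (λ x → p ∣ x ℕ.* x ℕ.+ 1) (upTo p)
      root = lose (∈-upTo⁺ (m%n<n (n !) p)) (square-root-of-minus-one t n≡t+t)
    ... | t , inj₂ n≡1+t+t = begin
      legendreMinus1 p        ≡⟨ cong (λ b → if b then 1ℚ else - 1ℚ) (dec-false root? no-root) ⟩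
      - 1ℚ                    ≡⟨ [-1]^[1+n+n]≡-1 t ⟨
      (- 1ℚ) ^ suc (t ℕ.+ t)  ≡⟨ cong ((- 1ℚ) ^_) n≡1+t+t ⟨
      (- 1ℚ) ^ n              ∎
      where
      open ≡-Reasoning
      no-root : ¬ Any (λ x → p ∣ x ℕ.* x ℕ.+ 1) (upTo p)
      no-root any = let (x , p∣x²+1) = satisfied any in no-square-root-of-minus-one t n≡1+t+t x p∣x²+1

    -- The central binomial sum modulo p²

    integral-½ : Integral ½
    integral-½ = integral-recip< 2 2<p

    integral-harmonicGap : ∀ k → Integral (harmonicGap n k)
    integral-harmonicGap k = integral-- (harmonic n) (harmonic (n ℕ.∸ k))
      (integral-harmonic n n<p) (integral-harmonic (n ℕ.∸ k) (ℕₚ.≤-<-trans (ℕₚ.m∸n≤m n k) n<p))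

    nℚ-odd-complement : ∀ k → k ≤ n → nℚ (suc (2 ℕ.* k)) ≡ P - nℚ 2 * nℚ (n ℕ.∸ k)
    nℚ-odd-complement k k≤n = begin
      nℚ (suc (2 ℕ.* k))                                 ≡⟨ add-sub (nℚ (suc (2 ℕ.* k))) (nℚ 2 * M) ⟩
      nℚ (suc (2 ℕ.* k)) + nℚ 2 * M - nℚ 2 * M           ≡⟨ cong (λ u → nℚ (suc (2 ℕ.* k)) + u - nℚ 2 * M) (nℚ-homo-* 2 (n ℕ.∸ k)) ⟨
      nℚ (suc (2 ℕ.* k)) + nℚ (2 ℕ.* (n ℕ.∸ k)) - nℚ 2 * M ≡⟨ cong (_- nℚ 2 * M) (nℚ-homo-+ (suc (2 ℕ.* k)) (2 ℕ.* (n ℕ.∸ k))) ⟨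
      nℚ (suc (2 ℕ.* k) ℕ.+ 2 ℕ.* (n ℕ.∸ k)) - nℚ 2 * M  ≡⟨ cong (λ j → nℚ (suc j) - nℚ 2 * M) sum≡ ⟩
      P - nℚ 2 * M                                       ∎
      where
      open ≡-Reasoning
      M = nℚ (n ℕ.∸ k)
      add-sub : ∀ a b → a ≡ a + b - b
      add-sub = solve-∀ ℚ-ring
      sum≡ : 2 ℕ.* k ℕ.+ 2 ℕ.* (n ℕ.∸ k) ≡ m
      sum≡ = begin
        2 ℕ.* k ℕ.+ 2 ℕ.* (n ℕ.∸ k)  ≡⟨ ℕₚ.*-distribˡ-+ 2 k (n ℕ.∸ k) ⟨
        2 ℕ.* (k ℕ.+ (n ℕ.∸ k))      ≡⟨ cong (2 ℕ.*_) (ℕₚ.m+[n∸m]≡n k≤n) ⟩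
        2 ℕ.* n                      ≡⟨ cong (n ℕ.+_) (ℕₚ.+-identityʳ n) ⟩
        n ℕ.+ n                      ≡⟨ m≡n+n ⟨
        m                            ∎

    leadingTerm : ℕ → ℚ
    leadingTerm k = binom n k * (- nℚ 2) ^ k

    integral-leadingTerm : ∀ k → Integral (leadingTerm k)
    integral-leadingTerm k = integral-* (binom n k) ((- nℚ 2) ^ k) (integral-binom n k) (integral-^ (- nℚ 2) k integral-[-2])

    ratio : ℕ → ℚ
    ratio k = - nℚ 2 * nℚ (n ℕ.∸ k) * recip (suc k)

    integral-ratio : ∀ k → k < n → Integral (ratio k)
    integral-ratio k k<n = integral-* (- nℚ 2 * nℚ (n ℕ.∸ k)) (recip (suc k))
      (integral-* (- nℚ 2) (nℚ (n ℕ.∸ k)) integral-[-2] (integral-nℚ (n ℕ.∸ k)))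
      (integral-recip< (suc k) (ℕₚ.≤-trans (s≤s k<n) n<p))

    integral-recip[n∸k] : ∀ k → Integral (recip (n ℕ.∸ k))
    integral-recip[n∸k] k = integral-recip< (n ℕ.∸ k) (ℕₚ.≤-<-trans (ℕₚ.m∸n≤m n k) n<p)

    leadingTerm-suc : ∀ k → k < n → leadingTerm (suc k) ≡ ratio k * leadingTerm k
    leadingTerm-suc k k<n = begin
      binom n (suc k) * (- nℚ 2 * (- nℚ 2) ^ k)
        ≡⟨ cong (_* (- nℚ 2 * (- nℚ 2) ^ k)) (*nℚ≡⇒≡*recip (binom n (suc k)) _ (suc k) (binom-suc-ratio n k (ℕₚ.<⇒≤ k<n))) ⟩
      binom n k * nℚ (n ℕ.∸ k) * recip (suc k) * (- nℚ 2 * (- nℚ 2) ^ k)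
        ≡⟨ regroup (binom n k) (nℚ (n ℕ.∸ k)) (recip (suc k)) ((- nℚ 2) ^ k) ⟩
      ratio k * leadingTerm k ∎
      where
      open ≡-Reasoning
      regroup : ∀ b M r w → b * M * r * (- nℚ 2 * w) ≡ - nℚ 2 * M * r * (b * w)
      regroup = solve-∀ ℚ-ring

    centralTerm-suc-factor : ∀ k → k < n →
      centralTerm (suc k) ≡ ratio k * (1ℚ - P * (½ * recip (n ℕ.∸ k))) * centralTerm k
    centralTerm-suc-factor k k<n = begin
      centralTerm (suc k)                                 ≡⟨ *nℚ≡⇒≡*recip (centralTerm (suc k)) _ (suc k) (centralTerm-suc k) ⟩
      nℚ (suc (2 ℕ.* k)) * centralTerm k * recip (suc k)
        ≡⟨ cong (λ u → u * centralTerm k * recip (suc k)) (nℚ-odd-complement k (ℕₚ.<⇒≤ k<n)) ⟩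
      (P - nℚ 2 * M) * centralTerm k * recip (suc k)
        ≡⟨ cong (λ u → (u - nℚ 2 * M) * centralTerm k * recip (suc k)) (ℚₚ.*-identityʳ P) ⟨
      (P * 1ℚ - nℚ 2 * M) * centralTerm k * recip (suc k) ≡⟨ cong (λ u → (P * u - nℚ 2 * M) * centralTerm k * recip (suc k)) M*iM≡1 ⟨
      (P * (M * iM) - nℚ 2 * M) * centralTerm k * recip (suc k)
        ≡⟨ pull-out P M iM (centralTerm k) (recip (suc k)) ⟩
      ratio k * (1ℚ - P * (½ * iM)) * centralTerm k       ∎
      where
      open ≡-Reasoning
      M = nℚ (n ℕ.∸ k)
      iM = recip (n ℕ.∸ k)
      M*iM≡1 : M * iM ≡ 1ℚ
      M*iM≡1 = nℚ*recip≡1 (n ℕ.∸ k) {{ℕ.>-nonZero (ℕₚ.m<n⇒0<n∸m k<n)}}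
      pull-out : ∀ P M i c r → (P * (M * i) - nℚ 2 * M) * c * r ≡ - nℚ 2 * M * r * (1ℚ - P * (½ * i)) * c
      pull-out = solve-∀ ℚ-ring

    centralTerm-expansion : ∀ k → k ≤ n →
      centralTerm k ≡ leadingTerm k * (1ℚ - P * (½ * harmonicGap n k)) [mod P * P ]
    centralTerm-expansion zero    _     = mod-reflexive (sym (trans
      (cong (λ g → 1ℚ * 1ℚ * (1ℚ - P * (½ * g))) (harmonicGap-zero n)) (collapse P)))
      where
      collapse : ∀ P → 1ℚ * 1ℚ * (1ℚ - P * (½ * 0ℚ)) ≡ 1ℚ
      collapse = solve-∀ ℚ-ring
    centralTerm-expansion (suc k) k<n = begin
      centralTerm (suc k)
        ≡⟨ centralTerm-suc-factor k k<n ⟩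
      ratio k * Y * centralTerm k
        ≈⟨ mod-*ˡ (ratio k * Y) (integral-* (ratio k) Y (integral-ratio k k<n) integral-Y)
                  (centralTerm-expansion k (ℕₚ.<⇒≤ k<n)) ⟩
      ratio k * Y * (leadingTerm k * X)
        ≡⟨ regroup (ratio k) Y (leadingTerm k) X ⟩
      ratio k * leadingTerm k * (X * Y)
        ≡⟨ cong (_* (X * Y)) (leadingTerm-suc k k<n) ⟨
      leadingTerm (suc k) * (X * Y)
        ≈⟨ mod-*ˡ (leadingTerm (suc k)) (integral-leadingTerm (suc k)) (near-one-* (½ * g) (½ * iM) integral-½g integral-½iM) ⟩
      leadingTerm (suc k) * (1ℚ - P * (½ * g + ½ * iM))
        ≡⟨ cong (λ u → leadingTerm (suc k) * (1ℚ - P * u)) (ℚₚ.*-distribˡ-+ ½ g iM) ⟨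
      leadingTerm (suc k) * (1ℚ - P * (½ * (g + iM)))
        ≡⟨ cong (λ u → leadingTerm (suc k) * (1ℚ - P * (½ * u))) (harmonicGap-sucʳ n k k<n) ⟨
      leadingTerm (suc k) * (1ℚ - P * (½ * harmonicGap n (suc k))) ∎
      where
      open ≡[mod]-Reasoning (P * P)
      g = harmonicGap n k
      iM = recip (n ℕ.∸ k)
      X = 1ℚ - P * (½ * g)
      Y = 1ℚ - P * (½ * iM)
      integral-½g : Integral (½ * g)
      integral-½g = integral-* ½ g integral-½ (integral-harmonicGap k)
      integral-½iM : Integral (½ * iM)
      integral-½iM = integral-* ½ iM integral-½ (integral-recip[n∸k] k)
      integral-Y : Integral Y
      integral-Y = integral-near-one (½ * iM) integral-½iM
      regroup : ∀ a y u x → a * y * (u * x) ≡ a * u * (x * y)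
      regroup = solve-∀ ℚ-ring

    A = sumFrom1 n termA
    B = sumFrom1 n termB
    L = (- 1ℚ) ^ n

    integral-½LB : Integral (½ * L * B)
    integral-½LB = integral-* (½ * L) B (integral-* ½ L integral-½ (integral-[-1]^ n))
      (integral-sumFrom1 n termB (λ k k≤n → integral-termB k (ℕₚ.≤-<-trans k≤n n<p)))

    central-sum-expansion : 1ℚ + A ≡ L + - (P * ½) * (L * B) [mod P * P ]
    central-sum-expansion = begin
      1ℚ + A                                              ≡⟨ cong (_+_ 1ℚ) (sumFrom1-cong n termA≡centralTerm) ⟩
      1ℚ + sumFrom1 n centralTerm                         ≡⟨ sumTo≡f0+sumFrom1 n centralTerm ⟨
      sumTo n centralTerm                                 ≈⟨ mod-sumTo n centralTerm-expansion ⟩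
      sumTo n (λ k → leadingTerm k * (1ℚ - P * (½ * g k)))          ≡⟨ sumTo-cong n (λ k _ → split P (leadingTerm k) (g k)) ⟩
      sumTo n (λ k → leadingTerm k + - (P * ½) * (leadingTerm k * g k))
        ≡⟨ sumTo-distrib-+ n leadingTerm (λ k → - (P * ½) * (leadingTerm k * g k)) ⟩
      sumTo n leadingTerm + sumTo n (λ k → - (P * ½) * (leadingTerm k * g k))
        ≡⟨ cong (_+_ (sumTo n leadingTerm)) (*-distribˡ-sumTo n (- (P * ½)) (λ k → leadingTerm k * g k)) ⟩
      sumTo n leadingTerm + - (P * ½) * binomialHarmonicSum (- nℚ 2) n
        ≡⟨ cong₂ (λ u v → u + - (P * ½) * v) (binomial-theorem (- nℚ 2) n) (binomialHarmonicSum-at-minus-two n) ⟩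
      L + - (P * ½) * (L * B)                             ∎
      where
      open ≡[mod]-Reasoning (P * P)
      g = harmonicGap n
      split : ∀ P u g → u * (1ℚ - P * (½ * g)) ≡ u + - (P * ½) * (u * g)
      split = solve-∀ ℚ-ring

    congruence-mod-p² : A ≡ - (P * ½) * L * B + L - 1ℚ [mod P * P ]
    congruence-mod-p² = begin
      A                                    ≡⟨ add-sub A ⟩
      1ℚ + A - 1ℚ                          ≈⟨ mod-+ central-sum-expansion (mod-refl { - 1ℚ}) ⟩
      L + - (P * ½) * (L * B) - 1ℚ         ≡⟨ regroup L P B ⟩
      - (P * ½) * L * B + L - 1ℚ           ∎
      where
      open ≡[mod]-Reasoning (P * P)
      add-sub : ∀ a → a ≡ 1ℚ + a - 1ℚ
      add-sub = solve-∀ ℚ-ring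
      regroup : ∀ L P B → L + - (P * ½) * (L * B) - 1ℚ ≡ - (P * ½) * L * B + L - 1ℚ
      regroup = solve-∀ ℚ-ring

    congruence-mod-p : A ≡ L - 1ℚ [mod P ]
    congruence-mod-p = begin
      A                                    ≈⟨ mod-weaken P (integral-nℚ p) congruence-mod-p² ⟩
      - (P * ½) * L * B + L - 1ℚ           ≡⟨ regroup L P B ⟩
      P * - (½ * L * B) + (L - 1ℚ)         ≈⟨ mod-+ (multiple≡0 P _ (integral-neg (½ * L * B) integral-½LB)) (mod-refl {L - 1ℚ}) ⟩
      0ℚ + (L - 1ℚ)                        ≡⟨ ℚₚ.+-identityˡ (L - 1ℚ) ⟩
      L - 1ℚ                               ∎
      where
      open ≡[mod]-Reasoning P
      regroup : ∀ L P B → - (P * ½) * L * B + L - 1ℚ ≡ P * - (½ * L * B) + (L - 1ℚ)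
      regroup = solve-∀ ℚ-ring

    congruences : CongModPow p 2 A (- (P * ½) * L * B + L - 1ℚ) × CongModPow p 1 A (L - 1ℚ)
    congruences = ≡[mod]⇒CongModPow 2 (mod-modulus (cong (P *_) (sym (ℚₚ.*-identityʳ P))) congruence-mod-p²)
                , ≡[mod]⇒CongModPow 1 (mod-modulus (sym (ℚₚ.*-identityʳ P)) congruence-mod-p)

corollary1p3 : (p : ℕ) → Prime p → ¬ (p ≡ 2) →
    CongModPow p 2 (sumFrom1 ((p ∸ 1) / 2) termA)
      (- (nℚ p * ½) * legendreMinus1 p * sumFrom1 ((p ∸ 1) / 2) termB
        + legendreMinus1 p - 1ℚ)
    × CongModPow p 1 (sumFrom1 ((p ∸ 1) / 2) termA) (legendreMinus1 p - 1ℚ)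
corollary1p3 zero    p-prime _   = ⊥-elim (¬prime[0] p-prime)
corollary1p3 (suc m) p-prime p≢2 with odd-prime-predecessor m p-prime p≢2
... | n , m≡n+n
  rewrite trans (cong (_/ 2) m≡n+n) ([n+n]/2≡n n) | PIntegral.OddPrime.legendre m p-prime n m≡n+n
  = PIntegral.OddPrime.congruences m p-prime n m≡n+n
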